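{- Let $n\ge1$, $r\ge1$ be integers and let $\lambda(x)=\exp\left(\frac{2\pi\sqrt{ -1}\,ax}{n}\right)$ be an additive character of $\mathbb{Z}_n$ with $a\in\mathbb{Z}$, $\gcd(a,n)=1$ (i.e. $\lambda$ has order $n$). Then $$G(\mathrm{SL}_r(\mathbb{Z}_n),\lambda)=n^{\frac{r(r-1)}{2}}K_r(\mathbb{Z}_n,\lambda).$$
   Context: $\mathbb{Z}_n=\mathbb{Z}/n\mathbb{Z}$; $\mathrm{SL}_r(\mathbb{Z}_n)$ is the group of $r\times r$ matrices over $\mathbb{Z}_n$ with determinant $1$. $G(\mathrm{SL}_r(\mathbb{Z}_n),\lambda)=\sum_{X\in\mathrm{SL}_r(\mathbb{Z}_n)}\lambda(\mathrm{tr}\,X)$, and the hyper-Kloosterman sum is $K_r(\mathbb{Z}_n,\lambda)=\sum_{x_1,\dots,x_r\in\mathbb{Z}_n,\ x_1x_2\cdots x_r=1}\lambda(x_1+x_2+\cdots+x_r)$. -}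

module Defs where

open import Level using (_⊔_)
open import Data.Nat as ℕ using (ℕ; zero; suc; _<_; NonZero)
open import Data.Nat.DivMod using (_%_)
open import Data.Fin using (Fin; zero; suc; toℕ; punchIn)
open import Data.Integer as ℤ using (ℤ; +_; 1ℤ; -1ℤ)
open import Data.Integer.DivMod using (_%ℕ_)
open import Data.Sum using (_⊎_)
open import Data.Product using (_×_)
open import Data.Bool using (if_then_else_)
open import Relation.Nullary using (Dec; ¬_)
open import Relation.Nullary.Decidable using (⌊_⌋)
open import Relation.Binary.PropositionalEquality using (_≡_)
open import Algebra.Bundles using (CommutativeRing)

sumℤ : ∀ k → (Fin k → ℤ) → ℤ
sumℤ zero    f = + 0
sumℤ (suc k) f = f zero ℤ.+ sumℤ k (λ i → f (suc i))

minor : ∀ {A : Set} {r} → (Fin (suc r) → Fin (suc r) → A) → Fin (suc r) → Fin r → Fin r → A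
minor M j i k = M (suc i) (punchIn j k)

detℤ : ∀ r → (Fin r → Fin r → ℤ) → ℤ
detℤ zero    M = 1ℤ
detℤ (suc r) M = sumℤ (suc r) (λ j → (-1ℤ ℤ.^ toℕ j) ℤ.* M zero j ℤ.* detℤ r (minor M j))

Mat : ℕ → ℕ → Set
Mat r n = Fin r → Fin r → Fin n

-- trace (as a natural representative; only its class mod n matters below)
trℕ : ∀ r {n} → Mat r n → ℕ
trℕ zero    X = 0
trℕ (suc r) X = toℕ (X zero zero) ℕ.+ trℕ r (λ i j → X (suc i) (suc j))

prodℕ : ∀ k {n} → (Fin k → Fin n) → ℕ
prodℕ zero    x = 1
prodℕ (suc k) x = toℕ (x zero) ℕ.* prodℕ k (λ i → x (suc i))

sumℕ : ∀ k {n} → (Fin k → Fin n) → ℕ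
sumℕ zero    x = 0
sumℕ (suc k) x = toℕ (x zero) ℕ.+ sumℕ k (λ i → x (suc i))

module _ {c ℓ} (R : CommutativeRing c ℓ) where
  open CommutativeRing R using (Carrier; _≈_; _+_; _*_; 0#; 1#)

  pow : Carrier → ℕ → Carrier
  pow x zero    = 1#
  pow x (suc k) = x * pow x k

  fromℕ : ℕ → Carrier
  fromℕ zero    = 0#
  fromℕ (suc k) = 1# + fromℕ k

  IsIntegralDomain : Set (c ⊔ ℓ)
  IsIntegralDomain = ∀ x y → x * y ≈ 0# → x ≈ 0# ⊎ y ≈ 0#

  CharZero : Set ℓ
  CharZero = ∀ m → ¬ (fromℕ (suc m) ≈ 0#)

  IsPrimitiveRoot : ℕ → Carrier → Set ℓ
  IsPrimitiveRoot n ζ = pow ζ n ≈ 1# × (∀ k → 0 < k → k < n → ¬ (pow ζ k ≈ 1#))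

  ΣFin : ∀ n → (Fin n → Carrier) → Carrier
  ΣFin zero    f = 0#
  ΣFin (suc n) f = f zero + ΣFin n (λ i → f (suc i))

  ΣFun : ∀ {A : Set} → ((A → Carrier) → Carrier) → ∀ k → ((Fin k → A) → Carrier) → Carrier
  ΣFun ΣA zero    f = f (λ ())
  ΣFun ΣA (suc k) f = ΣA (λ x → ΣFun ΣA k (λ g → f (λ { zero → x ; (suc i) → g i })))

  when : ∀ {p} {P : Set p} → Dec P → Carrier → Carrier
  when d x = if ⌊ d ⌋ then x else 0#

  -- additive character λ(x) = ζ^(a x) of ℤ_n, where ζ is a primitive n-th root of unity
  -- (the analogue of exp(2πi a x / n)); x given by a natural representative.
  addChar : ∀ n .{{_ : NonZero n}} → Carrier → ℤ → ℕ → Carrier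
  addChar n ζ a x = pow ζ ((a %ℕ n) ℕ.* x)

  GaussSL : ∀ n .{{_ : NonZero n}} → Carrier → ℤ → ℕ → Carrier
  GaussSL n ζ a r =
    ΣFun (ΣFun (ΣFin n) r) r (λ X →
      when (detℤ r (λ i j → + toℕ (X i j)) %ℕ n ℕ.≟ 1 % n) (addChar n ζ a (trℕ r X)))

  Kloosterman : ∀ n .{{_ : NonZero n}} → Carrier → ℤ → ℕ → Carrier
  Kloosterman n ζ a r =
    ΣFun (ΣFin n) r (λ x →
      when (prodℕ r x % n ℕ.≟ 1 % n) (addChar n ζ a (sumℕ r x)))

module Submission where

-- Generalise both sides to a residue d of the determinant, resp. of the product:
-- G_r(d) = Σ_{X ∈ M_r(ℤ_n), det X ≡ d} ψ(tr X) and K_r(d) = Σ_{x₁⋯x_r ≡ d} ψ(x₁ + ⋯ + x_r),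
-- and prove G_r(d) = n^(r choose 2) K_r(d) for all d by induction on r. Expanding det X along
-- the first row x gives det X = x · c, with c the cofactors of the lower rows. The sum of ψ(x₀)
-- over {x · c ≡ d} vanishes as soon as some c_j with j ≥ 1 is nonzero mod n: translating x₀ by
-- c_j and x_j by -c₀ keeps x · c and multiplies the sum by ψ(c_j) ≠ 1, which in an integral
-- domain forces the sum to be 0. Writing the lower rows as (v | B), Cramer's rule shows that if
-- det B is a unit mod n only v = 0 leaves all those cofactors zero; if it is not, the remaining
-- one-variable sum Φ_d(det B) = Σ_{x · det B ≡ d} ψ(x) vanishes by the same translation argument.
-- Either way G_{r+1}(d) = n^r Σ_B Φ_d(det B) ψ(tr B) = n^r Σ_t Φ_d(t) G_r(t), while
-- K_{r+1}(d) = Σ_t Φ_d(t) K_r(t) by splitting off x₁.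

open import Data.Nat using (ℕ; suc)
open import Data.Nat.Coprimality using (Coprime)
open import Algebra.Bundles using (CommutativeRing)
open import Defs

module NatLemmas where

  open import Data.Nat as ℕ using (zero; suc)
  import Data.Nat.Properties as ℕ
  import Data.Nat.Tactic.RingSolver as ℕ
  open import Data.Nat.DivMod using (_/_; m*n/n≡m)
  open import Data.Nat.Combinatorics using (_C_; nC1≡n; nCk+nC[k+1]≡[n+1]C[k+1])
  open import Data.Empty using (⊥-elim)
  open import Relation.Binary.PropositionalEquality as ≡ using (_≡_; _≢_)

  n+nC2≡[1+n]C2 : ∀ n → n ℕ.+ n C 2 ≡ suc n C 2
  n+nC2≡[1+n]C2 n = ≡.trans (≡.cong (ℕ._+ n C 2) (≡.sym (nC1≡n n))) (nCk+nC[k+1]≡[n+1]C[k+1] n 1)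

  nC2*2≡n[n∸1] : ∀ n → (n C 2) ℕ.* 2 ≡ n ℕ.* (n ℕ.∸ 1)
  nC2*2≡n[n∸1] zero = ≡.refl
  nC2*2≡n[n∸1] (suc zero) = ≡.refl
  nC2*2≡n[n∸1] (suc (suc n)) = begin
    (suc (suc n) C 2) ℕ.* 2            ≡⟨ ≡.cong (ℕ._* 2) (n+nC2≡[1+n]C2 (suc n)) ⟨
    (suc n ℕ.+ suc n C 2) ℕ.* 2        ≡⟨ ℕ.*-distribʳ-+ 2 (suc n) (suc n C 2) ⟩
    suc n ℕ.* 2 ℕ.+ (suc n C 2) ℕ.* 2  ≡⟨ ≡.cong (suc n ℕ.* 2 ℕ.+_) (nC2*2≡n[n∸1] (suc n)) ⟩
    suc n ℕ.* 2 ℕ.+ suc n ℕ.* n        ≡⟨ eq n ⟩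
    suc (suc n) ℕ.* suc n              ∎
    where
    open ≡.≡-Reasoning
    eq : ∀ n → suc n ℕ.* 2 ℕ.+ suc n ℕ.* n ≡ suc (suc n) ℕ.* suc n
    eq = ℕ.solve-∀

  nC2≡n[n∸1]/2 : ∀ n → n C 2 ≡ (n ℕ.* (n ℕ.∸ 1)) / 2
  nC2≡n[n∸1]/2 n = ≡.trans (≡.sym (m*n/n≡m (n C 2) 2)) (≡.cong (_/ 2) (nC2*2≡n[n∸1] n))

  ≢0∧≢1⇒nonTrivial : ∀ {g} → g ≢ 0 → g ≢ 1 → ℕ.NonTrivial g
  ≢0∧≢1⇒nonTrivial {zero} g≢0 _ = ⊥-elim (g≢0 ≡.refl)
  ≢0∧≢1⇒nonTrivial {suc zero} _ g≢1 = ⊥-elim (g≢1 ≡.refl)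
  ≢0∧≢1⇒nonTrivial {suc (suc g)} _ _ = _

module Congruence where

  open import Data.Nat as ℕ using (ℕ; NonZero)
  import Data.Nat.Properties as ℕ
  import Data.Nat.Divisibility as ℕ
  import Data.Nat.DivMod as ℕ
  import Data.Nat.GCD as ℕ
  open import Data.Nat.Coprimality using (Coprime)
  open import Data.Integer as ℤ using (ℤ; +_; 0ℤ; 1ℤ; _+_; _*_; -_; _-_)
  import Data.Integer.Properties as ℤ
  open import Data.Integer.DivMod using (_%ℕ_; _/ℕ_; a≡a%ℕn+[a/ℕn]*n; n%ℕd<d)
  open import Data.Integer.Divisibility.Signed
  open import Data.Integer.GCD using (gcd)
  open import Data.Integer.Tactic.RingSolver using (solve-∀)
  open import Data.Product using (_,_)
  open import Data.Sum using (inj₁; inj₂)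
  open import Relation.Binary.PropositionalEquality

  infix 4 _≡_mod_

  record _≡_mod_ (x y : ℤ) (n : ℕ) : Set where
    constructor congruent
    field n∣x-y : + n ∣ x - y

  open _≡_mod_ public using (n∣x-y)

  module _ {n : ℕ} where

    private
      ∣-resp : ∀ {x y} → x ≡ y → + n ∣ x → + n ∣ y
      ∣-resp = subst (+ n ∣_)

    ≡⇒≡-mod : ∀ {x y} → x ≡ y → x ≡ y mod n
    ≡⇒≡-mod {x} refl = congruent (divides 0ℤ (ℤ.+-inverseʳ x))

    ≡-mod-refl : ∀ {x} → x ≡ x mod n
    ≡-mod-refl = ≡⇒≡-mod refl

    ≡-mod-sym : ∀ {x y} → x ≡ y mod n → y ≡ x mod n
    ≡-mod-sym {x} {y} (congruent p) = congruent (∣-resp (eq x y) (∣m⇒∣-m p))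
      where eq : ∀ x y → - (x - y) ≡ y - x
            eq = solve-∀

    ≡-mod-trans : ∀ {x y z} → x ≡ y mod n → y ≡ z mod n → x ≡ z mod n
    ≡-mod-trans {x} {y} {z} (congruent p) (congruent q) =
      congruent (∣-resp (ℤ.+-minus-telescope x y z) (∣m∣n⇒∣m+n p q))

    +-cong-mod : ∀ {x x′ y y′} → x ≡ x′ mod n → y ≡ y′ mod n → x + y ≡ x′ + y′ mod n
    +-cong-mod {x} {x′} {y} {y′} (congruent p) (congruent q) =
      congruent (∣-resp (eq x x′ y y′) (∣m∣n⇒∣m+n p q))
      where eq : ∀ x x′ y y′ → (x - x′) + (y - y′) ≡ (x + y) - (x′ + y′)
            eq = solve-∀

    *-cong-mod : ∀ {x x′ y y′} → x ≡ x′ mod n → y ≡ y′ mod n → x * y ≡ x′ * y′ mod n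
    *-cong-mod {x} {x′} {y} {y′} (congruent p) (congruent q) =
      congruent (∣-resp (eq x x′ y y′) (∣m∣n⇒∣m+n (∣n⇒∣m*n x q) (∣m⇒∣m*n y′ p)))
      where eq : ∀ x x′ y y′ → x * (y - y′) + (x - x′) * y′ ≡ x * y - x′ * y′
            eq = solve-∀

    ∣⇒≡0-mod : ∀ {a} → n ℕ.∣ a → + a ≡ 0ℤ mod n
    ∣⇒≡0-mod {a} n∣a = congruent (∣-resp (sym (ℤ.+-identityʳ (+ a))) (∣ᵤ⇒∣ n∣a))

    ≡0-mod⇒∣ : ∀ {a} → + a ≡ 0ℤ mod n → n ℕ.∣ a
    ≡0-mod⇒∣ {a} (congruent p) = ∣⇒∣ᵤ (∣-resp (ℤ.+-identityʳ (+ a)) p)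

  module _ {n : ℕ} .{{_ : NonZero n}} where

    ≡-mod-%ℕ : ∀ x → x ≡ + (x %ℕ n) mod n
    ≡-mod-%ℕ x = congruent (divides (x /ℕ n) (begin
      x - + (x %ℕ n)                                   ≡⟨ cong (_- + (x %ℕ n)) (a≡a%ℕn+[a/ℕn]*n x n) ⟩
      (+ (x %ℕ n) + (x /ℕ n) * + n) - + (x %ℕ n)      ≡⟨ eq (+ (x %ℕ n)) (x /ℕ n) (+ n) ⟩
      (x /ℕ n) * + n                                   ∎))
      where
      open ≡-Reasoning
      eq : ∀ r q m → (r + q * m) - r ≡ q * m
      eq = solve-∀

    private
      ≤-mod-unique : ∀ {a b} → a ℕ.≤ b → b ℕ.< n → + a ≡ + b mod n → a ≡ b
      ≤-mod-unique {a} {b} a≤b b<n p = ℕ.≤-antisym a≤b (ℕ.m∸n≡0⇒m≤n b∸a≡0)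
        where
        n∣b∸a : n ℕ.∣ b ℕ.∸ a
        n∣b∸a = subst (n ℕ.∣_) (trans (cong ℤ.∣_∣ (ℤ.m-n≡m⊖n a b)) (ℤ.∣⊖∣-≤ a≤b))
                      (∣⇒∣ᵤ (n∣x-y p))
        b∸a≡0 : b ℕ.∸ a ≡ 0
        b∸a≡0 = trans (sym (ℕ.m<n⇒m%n≡m (ℕ.≤-<-trans (ℕ.m∸n≤m b a) b<n)))
                      (ℕ.n∣m⇒m%n≡0 _ n n∣b∸a)

    <-mod-unique : ∀ {a b} → a ℕ.< n → b ℕ.< n → + a ≡ + b mod n → a ≡ b
    <-mod-unique {a} {b} a<n b<n p with ℕ.≤-total a b
    ... | inj₁ a≤b = ≤-mod-unique a≤b b<n p
    ... | inj₂ b≤a = sym (≤-mod-unique b≤a a<n (≡-mod-sym p))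

    ≡-mod⇒%ℕ≡ : ∀ {x y} → x ≡ y mod n → x %ℕ n ≡ y %ℕ n
    ≡-mod⇒%ℕ≡ {x} {y} p = <-mod-unique (n%ℕd<d x n) (n%ℕd<d y n)
      (≡-mod-trans (≡-mod-sym (≡-mod-%ℕ x)) (≡-mod-trans p (≡-mod-%ℕ y)))

    %ℕ≡⇒≡-mod : ∀ {x y} → x %ℕ n ≡ y %ℕ n → x ≡ y mod n
    %ℕ≡⇒≡-mod {x} {y} e =
      ≡-mod-trans (≡-mod-%ℕ x) (≡-mod-trans (≡⇒≡-mod (cong +_ e)) (≡-mod-sym (≡-mod-%ℕ y)))

  coprime-%ℕ : ∀ {n} .{{_ : NonZero n}} a → gcd a (+ n) ≡ 1ℤ → Coprime n (a %ℕ n)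
  coprime-%ℕ {n} a gcd≡1 {d} (d∣n , d∣α) =
    ℕ.∣1⇒≡1 (subst (d ℕ.∣_) (ℤ.+-injective gcd≡1) (ℕ.gcd-greatest d∣∣a∣ d∣n))
    where
    d∣∣a∣ : d ℕ.∣ ℤ.∣ a ∣
    d∣∣a∣ = ∣⇒∣ᵤ (subst (+ d ∣_) (eq a (+ (a %ℕ n)))
                   (∣m∣n⇒∣m+n (∣-trans (∣ᵤ⇒∣ d∣n) (n∣x-y (≡-mod-%ℕ a))) (∣ᵤ⇒∣ d∣α)))
      where eq : ∀ a α → (a ℤ.- α) ℤ.+ α ≡ a
            eq = solve-∀

module RingLemmas where

  open import Data.Nat as ℕ using (zero; suc)
  import Data.Nat.Properties as ℕ
  import Data.Nat.DivMod as ℕ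
  open import Data.Empty using (⊥-elim)
  open import Data.Sum using (inj₁; inj₂)
  open import Relation.Nullary using (¬_; Dec; yes; no)
  import Relation.Binary.PropositionalEquality as ≡

  module _ {c ℓ} (R : CommutativeRing c ℓ) where
    open CommutativeRing R hiding (zero)
    open import Relation.Binary.Reasoning.Setoid setoid

    fromℕ-+ : ∀ a b → fromℕ R (a ℕ.+ b) ≈ fromℕ R a + fromℕ R b
    fromℕ-+ zero b = sym (+-identityˡ _)
    fromℕ-+ (suc a) b = trans (+-congˡ (fromℕ-+ a b)) (sym (+-assoc _ _ _))

    fromℕ-* : ∀ a b → fromℕ R (a ℕ.* b) ≈ fromℕ R a * fromℕ R b
    fromℕ-* zero b = sym (zeroˡ _)
    fromℕ-* (suc a) b = begin
      fromℕ R (b ℕ.+ a ℕ.* b)              ≈⟨ fromℕ-+ b (a ℕ.* b) ⟩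
      fromℕ R b + fromℕ R (a ℕ.* b)        ≈⟨ +-cong (sym (*-identityˡ _)) (fromℕ-* a b) ⟩
      1# * fromℕ R b + fromℕ R a * fromℕ R b ≈⟨ distribʳ _ _ _ ⟨
      (1# + fromℕ R a) * fromℕ R b         ∎

    fromℕ-1 : fromℕ R 1 ≈ 1#
    fromℕ-1 = +-identityʳ 1#

    pow-+ : ∀ x a b → pow R x (a ℕ.+ b) ≈ pow R x a * pow R x b
    pow-+ x zero b = sym (*-identityˡ _)
    pow-+ x (suc a) b = trans (*-congˡ (pow-+ x a b)) (sym (*-assoc _ _ _))

    pow-* : ∀ x a b → pow R x (a ℕ.* b) ≈ pow R (pow R x a) b
    pow-* x a zero = reflexive (≡.cong (pow R x) (ℕ.*-zeroʳ a))
    pow-* x a (suc b) = begin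
      pow R x (a ℕ.* suc b)          ≡⟨ ≡.cong (pow R x) (ℕ.*-suc a b) ⟩
      pow R x (a ℕ.+ a ℕ.* b)        ≈⟨ pow-+ x a _ ⟩
      pow R x a * pow R x (a ℕ.* b)  ≈⟨ *-congˡ (pow-* x a b) ⟩
      pow R x a * pow R (pow R x a) b ∎

    pow-cong : ∀ {x y} k → x ≈ y → pow R x k ≈ pow R y k
    pow-cong zero x≈y = refl
    pow-cong (suc k) x≈y = *-cong x≈y (pow-cong k x≈y)

    pow-1# : ∀ k → pow R 1# k ≈ 1#
    pow-1# zero = refl
    pow-1# (suc k) = trans (*-identityˡ _) (pow-1# k)

    pow-% : ∀ {x} n .{{_ : ℕ.NonZero n}} → pow R x n ≈ 1# → ∀ k → pow R x k ≈ pow R x (k ℕ.% n)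
    pow-% {x} n xⁿ≈1 k = begin
      pow R x k                        ≡⟨ ≡.cong (pow R x) (ℕ.m≡m%n+[m/n]*n k n) ⟩
      pow R x (r ℕ.+ q ℕ.* n)          ≈⟨ pow-+ x r (q ℕ.* n) ⟩
      pow R x r * pow R x (q ℕ.* n)    ≡⟨ ≡.cong (λ e → pow R x r * pow R x e) (ℕ.*-comm q n) ⟩
      pow R x r * pow R x (n ℕ.* q)    ≈⟨ *-congˡ (pow-* x n q) ⟩
      pow R x r * pow R (pow R x n) q  ≈⟨ *-congˡ (trans (pow-cong q xⁿ≈1) (pow-1# q)) ⟩
      pow R x r * 1#                   ≈⟨ *-identityʳ _ ⟩
      pow R x r                        ∎
      where
      q = k ℕ./ n
      r = k ℕ.% n

    when-yes : ∀ {p} {P : Set p} (d : Dec P) x → P → when R d x ≈ x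
    when-yes (yes _) x _ = refl
    when-yes (no ¬p) x p = ⊥-elim (¬p p)

    when-no : ∀ {p} {P : Set p} (d : Dec P) x → ¬ P → when R d x ≈ 0#
    when-no (yes p) x ¬p = ⊥-elim (¬p p)
    when-no (no _) x _ = refl

    when-cong : ∀ {p q} {P : Set p} {Q : Set q} (d : Dec P) (e : Dec Q) {x y} →
                (P → Q) → (Q → P) → x ≈ y → when R d x ≈ when R e y
    when-cong (yes p) (yes q) P→Q Q→P x≈y = x≈y
    when-cong (yes p) (no ¬q) P→Q Q→P x≈y = ⊥-elim (¬q (P→Q p))
    when-cong (no ¬p) (yes q) P→Q Q→P x≈y = ⊥-elim (¬p (Q→P q))
    when-cong (no ¬p) (no ¬q) P→Q Q→P x≈y = refl

    when-*ʳ : ∀ {p} {P : Set p} (d : Dec P) x y → when R d (x * y) ≈ when R d x * y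
    when-*ʳ (yes _) x y = refl
    when-*ʳ (no _) x y = sym (zeroˡ y)

    module _ (domain : IsIntegralDomain R) where
      open import Algebra.Properties.Ring ring using (-1*x≈-x)

      x≈wx⇒x≈0 : ∀ {w x} → ¬ (w ≈ 1#) → x ≈ w * x → x ≈ 0#
      x≈wx⇒x≈0 {w} {x} w≉1 x≈wx with domain (w - 1#) x [w-1]x≈0
        where
        [w-1]x≈0 : (w - 1#) * x ≈ 0#
        [w-1]x≈0 = begin
          (w - 1#) * x        ≈⟨ distribʳ x w (- 1#) ⟩
          w * x + - 1# * x    ≈⟨ +-cong (sym x≈wx) (-1*x≈-x x) ⟩
          x - x               ≈⟨ -‿inverseʳ x ⟩
          0#                  ∎
      ... | inj₂ x≈0 = x≈0
      ... | inj₁ w-1≈0 = ⊥-elim (w≉1 (begin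
          w                   ≈⟨ +-identityʳ w ⟨
          w + 0#              ≈⟨ +-congˡ (-‿inverseˡ 1#) ⟨
          w + (- 1# + 1#)     ≈⟨ +-assoc _ _ _ ⟨
          (w - 1#) + 1#       ≈⟨ +-congʳ w-1≈0 ⟩
          0# + 1#             ≈⟨ +-identityˡ 1# ⟩
          1#                  ∎))

module Summation where

  open import Level using (_⊔_)
  open import Data.Nat as ℕ using (zero; suc)
  open import Data.Fin using (Fin; zero; suc)
  open import Data.Fin.Properties using (suc-injective)
  open import Function using (_∘_)
  open import Relation.Binary.PropositionalEquality using (_≢_)
  open RingLemmas

  module _ {c ℓ} (R : CommutativeRing c ℓ) where
    open CommutativeRing R hiding (zero)
    open import Relation.Binary.Reasoning.Setoid setoid
    open import Algebra.Properties.CommutativeSemigroup +-commutativeSemigroup using (interchange)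

    record IsSummation {A : Set} (S : (A → Carrier) → Carrier) : Set (c ⊔ ℓ) where
      field
        Σ-cong : ∀ {f g} → (∀ a → f a ≈ g a) → S f ≈ S g
        Σ-zero : S (λ _ → 0#) ≈ 0#
        Σ-+    : ∀ f g → S (λ a → f a + g a) ≈ S f + S g
        Σ-*ˡ   : ∀ x f → S (λ a → x * f a) ≈ x * S f

      Σ-*ʳ : ∀ x f → S (λ a → f a * x) ≈ S f * x
      Σ-*ʳ x f = trans (Σ-cong (λ a → *-comm (f a) x)) (trans (Σ-*ˡ x f) (*-comm x _))

      Σ-≈0 : ∀ {f} → (∀ a → f a ≈ 0#) → S f ≈ 0#
      Σ-≈0 f≈0 = trans (Σ-cong f≈0) Σ-zero

    open IsSummation public

    SwapsWith : ∀ {A B : Set} → ((A → Carrier) → Carrier) → ((B → Carrier) → Carrier) → Set (c ⊔ ℓ)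
    SwapsWith {A} {B} SA SB = ∀ (f : A → B → Carrier) → SA (λ a → SB (f a)) ≈ SB (λ b → SA (λ a → f a b))

    ΣFin-isSummation : ∀ k → IsSummation (ΣFin R k)
    Σ-cong (ΣFin-isSummation zero) _ = refl
    Σ-cong (ΣFin-isSummation (suc k)) f≈g = +-cong (f≈g zero) (Σ-cong (ΣFin-isSummation k) (f≈g ∘ suc))
    Σ-zero (ΣFin-isSummation zero) = refl
    Σ-zero (ΣFin-isSummation (suc k)) = trans (+-congˡ (Σ-zero (ΣFin-isSummation k))) (+-identityʳ 0#)
    Σ-+ (ΣFin-isSummation zero) f g = sym (+-identityʳ 0#)
    Σ-+ (ΣFin-isSummation (suc k)) f g = trans (+-congˡ (Σ-+ (ΣFin-isSummation k) _ _)) (interchange _ _ _ _)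
    Σ-*ˡ (ΣFin-isSummation zero) x f = sym (zeroʳ x)
    Σ-*ˡ (ΣFin-isSummation (suc k)) x f = trans (+-congˡ (Σ-*ˡ (ΣFin-isSummation k) x _)) (sym (distribˡ x _ _))

    ΣFun-isSummation : ∀ {A : Set} {SA : (A → Carrier) → Carrier} →
                       IsSummation SA → ∀ k → IsSummation (ΣFun R SA k)
    Σ-cong (ΣFun-isSummation S zero) f≈g = f≈g _
    Σ-cong (ΣFun-isSummation S (suc k)) f≈g = Σ-cong S (λ _ → Σ-cong (ΣFun-isSummation S k) (λ _ → f≈g _))
    Σ-zero (ΣFun-isSummation S zero) = refl
    Σ-zero (ΣFun-isSummation S (suc k)) = Σ-≈0 S (λ _ → Σ-zero (ΣFun-isSummation S k))
    Σ-+ (ΣFun-isSummation S zero) f g = refl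
    Σ-+ (ΣFun-isSummation S (suc k)) f g = trans (Σ-cong S (λ _ → Σ-+ (ΣFun-isSummation S k) _ _)) (Σ-+ S _ _)
    Σ-*ˡ (ΣFun-isSummation S zero) x f = refl
    Σ-*ˡ (ΣFun-isSummation S (suc k)) x f = trans (Σ-cong S (λ _ → Σ-*ˡ (ΣFun-isSummation S k) x _)) (Σ-*ˡ S x _)

    ΣFin-swap : ∀ k {B : Set} {SB : (B → Carrier) → Carrier} → IsSummation SB → SwapsWith (ΣFin R k) SB
    ΣFin-swap zero SB f = sym (Σ-zero SB)
    ΣFin-swap (suc k) SB f = trans (+-congˡ (ΣFin-swap k SB _)) (sym (Σ-+ SB _ _))

    ΣFun-swap : ∀ {A : Set} {SA : (A → Carrier) → Carrier} → IsSummation SA →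
                (∀ {B : Set} {SB : (B → Carrier) → Carrier} → IsSummation SB → SwapsWith SA SB) →
                ∀ k {B : Set} {SB : (B → Carrier) → Carrier} → IsSummation SB → SwapsWith (ΣFun R SA k) SB
    ΣFun-swap SA swapA zero SB f = refl
    ΣFun-swap SA swapA (suc k) SB f = trans (Σ-cong SA (λ _ → ΣFun-swap SA swapA k SB _)) (swapA SB _)

    ΣFin-δ : ∀ k (f : Fin k → Carrier) i → (∀ j → j ≢ i → f j ≈ 0#) → ΣFin R k f ≈ f i
    ΣFin-δ (suc k) f zero f≈0 =
      trans (+-congˡ (Σ-≈0 (ΣFin-isSummation k) (λ j → f≈0 (suc j) (λ ())))) (+-identityʳ _)
    ΣFin-δ (suc k) f (suc i) f≈0 =
      trans (+-cong (f≈0 zero (λ ())) (ΣFin-δ k (f ∘ suc) i (λ j j≢i → f≈0 (suc j) (j≢i ∘ suc-injective))))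
            (+-identityˡ _)

    ΣFin-const : ∀ k x → ΣFin R k (λ _ → x) ≈ fromℕ R k * x
    ΣFin-const zero x = sym (zeroˡ x)
    ΣFin-const (suc k) x = begin
      x + ΣFin R k (λ _ → x)     ≈⟨ +-cong (sym (*-identityˡ x)) (ΣFin-const k x) ⟩
      1# * x + fromℕ R k * x     ≈⟨ distribʳ _ _ _ ⟨
      (1# + fromℕ R k) * x       ∎

    ΣFun-ΣFin-const : ∀ n k x → ΣFun R (ΣFin R n) k (λ _ → x) ≈ fromℕ R (n ℕ.^ k) * x
    ΣFun-ΣFin-const n zero x = trans (sym (*-identityˡ x)) (*-congʳ (sym (fromℕ-1 R)))
    ΣFun-ΣFin-const n (suc k) x = begin
      ΣFin R n (λ _ → ΣFun R (ΣFin R n) k (λ _ → x))  ≈⟨ Σ-cong (ΣFin-isSummation n) (λ _ → ΣFun-ΣFin-const n k x) ⟩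
      ΣFin R n (λ _ → fromℕ R (n ℕ.^ k) * x)          ≈⟨ ΣFin-const n _ ⟩
      fromℕ R n * (fromℕ R (n ℕ.^ k) * x)             ≈⟨ *-assoc _ _ _ ⟨
      fromℕ R n * fromℕ R (n ℕ.^ k) * x               ≈⟨ *-congʳ (fromℕ-* R n (n ℕ.^ k)) ⟨
      fromℕ R (n ℕ.* n ℕ.^ k) * x                     ∎

module VectorSums where

  open import Data.Nat as ℕ using (ℕ; zero; suc)
  import Data.Nat.Properties as ℕ
  import Data.Nat.DivMod as ℕ
  open import Data.Fin using (Fin; zero; suc; toℕ)
  import Data.Fin.Properties as Fin
  open import Data.Integer using (ℤ; +_)
  open import Data.Vec.Functional using (_∷_; updateAt; zipWith)
  open import Function using (_∘_; _$_)
  open import Relation.Nullary using (¬_)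
  open import Relation.Binary.PropositionalEquality as ≡ using (_≡_; _≗_)
  open Summation

  toℕ-mod : ∀ i n .{{_ : ℕ.NonZero n}} → toℕ (i ℕ.mod n) ≡ i ℕ.% n
  toℕ-mod i n = Fin.toℕ-fromℕ< (ℕ.m%n<n i n)

  toℕ-mod-cong : ∀ {i j} n .{{_ : ℕ.NonZero n}} → i ℕ.% n ≡ j ℕ.% n → i ℕ.mod n ≡ j ℕ.mod n
  toℕ-mod-cong n e = Fin.fromℕ<-cong _ _ e _ _

  mod-toℕ : ∀ {n} .{{_ : ℕ.NonZero n}} (x : Fin n) → toℕ x ℕ.mod n ≡ x
  mod-toℕ {n} x = ≡.trans (Fin.fromℕ<-cong _ _ (ℕ.m<n⇒m%n≡m (Fin.toℕ<n x)) _ (Fin.toℕ<n x))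
                           (Fin.fromℕ<-toℕ x (Fin.toℕ<n x))

  translate : ∀ {n} .{{_ : ℕ.NonZero n}} → ℕ → Fin n → Fin n
  translate {n} k x = (toℕ x ℕ.+ k) ℕ.mod n

  updateAt-resp-≗ : ∀ {A : Set} {k} (j : Fin k) (s : A → A) {x y : Fin k → A} →
                    x ≗ y → updateAt x j s ≗ updateAt y j s
  updateAt-resp-≗ zero s x≗y zero = ≡.cong s (x≗y zero)
  updateAt-resp-≗ zero s x≗y (suc i) = x≗y (suc i)
  updateAt-resp-≗ (suc j) s x≗y zero = x≗y zero
  updateAt-resp-≗ (suc j) s x≗y (suc i) = updateAt-resp-≗ j s (x≗y ∘ suc) i

  ∷-resp-≗ : ∀ {A : Set} {k} (a : A) {x y : Fin k → A} → x ≗ y → (a ∷ x) ≗ (a ∷ y)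
  ∷-resp-≗ a x≗y zero = ≡.refl
  ∷-resp-≗ a x≗y (suc i) = x≗y i

  prodℕ-cong : ∀ k {n} {x y : Fin k → Fin n} → x ≗ y → prodℕ k x ≡ prodℕ k y
  prodℕ-cong zero x≗y = ≡.refl
  prodℕ-cong (suc k) x≗y = ≡.cong₂ ℕ._*_ (≡.cong toℕ (x≗y zero)) (prodℕ-cong k (x≗y ∘ suc))

  sumℕ-cong : ∀ k {n} {x y : Fin k → Fin n} → x ≗ y → sumℕ k x ≡ sumℕ k y
  sumℕ-cong zero x≗y = ≡.refl
  sumℕ-cong (suc k) x≗y = ≡.cong₂ ℕ._+_ (≡.cong toℕ (x≗y zero)) (sumℕ-cong k (x≗y ∘ suc))

  trℕ-cong : ∀ r {n} {X Y : Mat r n} → (∀ i → X i ≗ Y i) → trℕ r X ≡ trℕ r Y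
  trℕ-cong zero X≗Y = ≡.refl
  trℕ-cong (suc r) X≗Y =
    ≡.cong₂ ℕ._+_ (≡.cong toℕ (X≗Y zero zero)) (trℕ-cong r (λ i j → X≗Y (suc i) (suc j)))

  ⟦_⟧ : ∀ {p k n} → (Fin p → Fin k → Fin n) → Fin p → Fin k → ℤ
  ⟦ X ⟧ i j = + toℕ (X i j)

  module _ {c ℓ} (R : CommutativeRing c ℓ) where
    open CommutativeRing R hiding (zero)
    open import Relation.Binary.Reasoning.Setoid setoid
    open import Algebra.Properties.Group +-group using (∙-cancelʳ)
    open import Algebra.Properties.CommutativeSemigroup ℕ.+-commutativeSemigroup using (xy∙z≈xz∙y)

    Σ< : ℕ → (ℕ → Carrier) → Carrier
    Σ< zero G = 0#
    Σ< (suc k) G = G 0 + Σ< k (G ∘ suc)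

    Σ<-cong : ∀ k {G H : ℕ → Carrier} → (∀ i → G i ≈ H i) → Σ< k G ≈ Σ< k H
    Σ<-cong zero G≈H = refl
    Σ<-cong (suc k) G≈H = +-cong (G≈H 0) (Σ<-cong k (G≈H ∘ suc))

    ΣFin-toℕ : ∀ k (G : ℕ → Carrier) → ΣFin R k (G ∘ toℕ) ≈ Σ< k G
    ΣFin-toℕ zero G = refl
    ΣFin-toℕ (suc k) G = +-congˡ (ΣFin-toℕ k (G ∘ suc))

    Σ<-last : ∀ k (G : ℕ → Carrier) → Σ< (suc k) G ≈ Σ< k G + G k
    Σ<-last zero G = trans (+-identityʳ _) (sym (+-identityˡ _))
    Σ<-last (suc k) G = trans (+-congˡ (Σ<-last k (G ∘ suc))) (sym (+-assoc _ _ _))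

    Periodic : ℕ → (ℕ → Carrier) → Set ℓ
    Periodic n G = ∀ i → G (i ℕ.+ n) ≈ G i

    Σ<-rotate : ∀ n G → Periodic n G → Σ< n (G ∘ suc) ≈ Σ< n G
    Σ<-rotate n G periodic = ∙-cancelʳ (G 0) _ _ (begin
      Σ< n (G ∘ suc) + G 0 ≈⟨ +-comm _ _ ⟩
      Σ< (suc n) G         ≈⟨ Σ<-last n G ⟩
      Σ< n G + G n         ≈⟨ +-congˡ (periodic 0) ⟩
      Σ< n G + G 0         ∎)

    Σ<-shift : ∀ n G → Periodic n G → ∀ k → Σ< n (λ i → G (i ℕ.+ k)) ≈ Σ< n G
    Σ<-shift n G periodic zero = Σ<-cong n (λ i → reflexive (≡.cong G (ℕ.+-identityʳ i)))
    Σ<-shift n G periodic (suc k) = begin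
      Σ< n (λ i → G (i ℕ.+ suc k)) ≈⟨ Σ<-cong n (λ i → reflexive (≡.cong G (ℕ.+-suc i k))) ⟩
      Σ< n (λ i → G (suc i ℕ.+ k)) ≈⟨ Σ<-rotate n (λ i → G (i ℕ.+ k)) shifted-periodic ⟩
      Σ< n (λ i → G (i ℕ.+ k))     ≈⟨ Σ<-shift n G periodic k ⟩
      Σ< n G                       ∎
      where
      shifted-periodic : Periodic n (λ i → G (i ℕ.+ k))
      shifted-periodic i = trans (reflexive (≡.cong G (xy∙z≈xz∙y i n k))) (periodic (i ℕ.+ k))

    ΣFin-translate : ∀ n .{{_ : ℕ.NonZero n}} k (H : Fin n → Carrier) →
                     ΣFin R n (H ∘ translate k) ≈ ΣFin R n H
    ΣFin-translate n k H = begin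
      ΣFin R n (λ x → G (toℕ x ℕ.+ k))  ≈⟨ ΣFin-toℕ n (λ i → G (i ℕ.+ k)) ⟩
      Σ< n (λ i → G (i ℕ.+ k))          ≈⟨ Σ<-shift n G periodic k ⟩
      Σ< n G                            ≈⟨ ΣFin-toℕ n G ⟨
      ΣFin R n (λ x → H (toℕ x ℕ.mod n))  ≈⟨ Σ-cong (ΣFin-isSummation R n) (reflexive ∘ ≡.cong H ∘ mod-toℕ) ⟩
      ΣFin R n H                        ∎
      where
      G : ℕ → Carrier
      G i = H (i ℕ.mod n)
      periodic : Periodic n G
      periodic i = reflexive (≡.cong H (toℕ-mod-cong n (ℕ.[m+n]%n≡m%n i n)))

    ΣVec : ∀ n k → ((Fin k → Fin n) → Carrier) → Carrier
    ΣVec n = ΣFun R (ΣFin R n)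

    ΣMat : ∀ n p k → ((Fin p → Fin k → Fin n) → Carrier) → Carrier
    ΣMat n p k = ΣFun R (ΣVec n k) p

    ΣVec-isSummation : ∀ n k → IsSummation R (ΣVec n k)
    ΣVec-isSummation n = ΣFun-isSummation R (ΣFin-isSummation R n)

    ΣVec-swap : ∀ n k {B : Set} {SB : (B → Carrier) → Carrier} → IsSummation R SB → SwapsWith R (ΣVec n k) SB
    ΣVec-swap n = ΣFun-swap R (ΣFin-isSummation R n) (ΣFin-swap R n)

    ΣMat-isSummation : ∀ n p k → IsSummation R (ΣMat n p k)
    ΣMat-isSummation n p k = ΣFun-isSummation R (ΣVec-isSummation n k) p

    Extensional : ∀ {A : Set} {k} → ((Fin k → A) → Carrier) → Set ℓ
    Extensional h = ∀ {x y} → x ≗ y → h x ≈ h y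

    Extensional₂ : ∀ {A : Set} {p k} → ((Fin p → Fin k → A) → Carrier) → Set ℓ
    Extensional₂ h = ∀ {X Y} → (∀ i → X i ≗ Y i) → h X ≈ h Y

    module _ {n : ℕ} where

      ΣVec-unfold : ∀ k {h : (Fin (suc k) → Fin n) → Carrier} → Extensional h →
                    ΣVec n (suc k) h ≈ ΣFin R n (λ y → ΣVec n k (λ x → h (y ∷ x)))
      ΣVec-unfold k ext = Σ-cong (ΣFin-isSummation R n) (λ y → Σ-cong (ΣVec-isSummation n k) (λ x →
        ext (λ { zero → ≡.refl ; (suc i) → ≡.refl })))

      ΣVec-updateAt : ∀ k (j : Fin k) (s : Fin n → Fin n) → (∀ H → ΣFin R n (H ∘ s) ≈ ΣFin R n H) →
                      {h : (Fin k → Fin n) → Carrier} → Extensional h →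
                      ΣVec n k (λ x → h (updateAt x j s)) ≈ ΣVec n k h
      ΣVec-updateAt (suc k) zero s s-invariant {h} ext = begin
        ΣVec n (suc k) (λ x → h (updateAt x zero s))       ≈⟨ ΣVec-unfold k (ext ∘ updateAt-resp-≗ zero s) ⟩
        ΣFin R n (λ y → ΣVec n k (λ x → h (updateAt (y ∷ x) zero s)))
          ≈⟨ Σ-cong (ΣFin-isSummation R n) (λ y → Σ-cong (ΣVec-isSummation n k) (λ x →
               ext (λ { zero → ≡.refl ; (suc i) → ≡.refl }))) ⟩
        ΣFin R n (λ y → ΣVec n k (λ x → h (s y ∷ x)))
                                                          ≈⟨ s-invariant (λ y → ΣVec n k (λ x → h (y ∷ x))) ⟩
        ΣFin R n (λ y → ΣVec n k (λ x → h (y ∷ x)))       ≈⟨ ΣVec-unfold k ext ⟨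
        ΣVec n (suc k) h                                  ∎
      ΣVec-updateAt (suc k) (suc j) s s-invariant {h} ext = begin
        ΣVec n (suc k) (λ x → h (updateAt x (suc j) s))   ≈⟨ ΣVec-unfold k (ext ∘ updateAt-resp-≗ (suc j) s) ⟩
        ΣFin R n (λ y → ΣVec n k (λ x → h (updateAt (y ∷ x) (suc j) s)))
          ≈⟨ Σ-cong (ΣFin-isSummation R n) (λ y → Σ-cong (ΣVec-isSummation n k) (λ x →
               ext (λ { zero → ≡.refl ; (suc i) → ≡.refl }))) ⟩
        ΣFin R n (λ y → ΣVec n k (λ x → h (y ∷ updateAt x j s)))
          ≈⟨ Σ-cong (ΣFin-isSummation R n) (λ y → ΣVec-updateAt k j s s-invariant (ext ∘ ∷-resp-≗ y)) ⟩
        ΣFin R n (λ y → ΣVec n k (λ x → h (y ∷ x)))       ≈⟨ ΣVec-unfold k ext ⟨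
        ΣVec n (suc k) h                                  ∎

      ΣVec-δ : ∀ k {h : (Fin k → Fin n) → Carrier} → Extensional h → ∀ p →
               (∀ x → ¬ (x ≗ p) → h x ≈ 0#) → ΣVec n k h ≈ h p
      ΣVec-δ zero ext p vanishes = ext (λ ())
      ΣVec-δ (suc k) {h} ext p vanishes = begin
        ΣVec n (suc k) h
          ≈⟨ ΣVec-unfold k ext ⟩
        ΣFin R n (λ y → ΣVec n k (λ x → h (y ∷ x)))
          ≈⟨ ΣFin-δ R n _ (p zero) (λ y y≢p₀ →
               Σ-≈0 (ΣVec-isSummation n k) (λ x → vanishes _ (y≢p₀ ∘ (_$ zero)))) ⟩
        ΣVec n k (λ x → h (p zero ∷ x))
          ≈⟨ ΣVec-δ k (ext ∘ ∷-resp-≗ (p zero)) (p ∘ suc) (λ x x≉p → vanishes _ (x≉p ∘ (_∘ suc))) ⟩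
        h (p zero ∷ (p ∘ suc))
          ≈⟨ ext (λ { zero → ≡.refl ; (suc i) → ≡.refl }) ⟩
        h p ∎

      ΣMat-unfold : ∀ p k {g : (Fin (suc p) → Fin k → Fin n) → Carrier} → Extensional₂ g →
                    ΣMat n (suc p) k g ≈ ΣVec n k (λ row → ΣMat n p k (λ B → g (row ∷ B)))
      ΣMat-unfold p k ext = Σ-cong (ΣVec-isSummation n k) (λ row → Σ-cong (ΣMat-isSummation n p k) (λ B →
        ext (λ { zero j → ≡.refl ; (suc i) j → ≡.refl })))

      ΣMat-columns : ∀ p k {g : (Fin p → Fin (suc k) → Fin n) → Carrier} → Extensional₂ g →
                     ΣMat n p (suc k) g ≈ ΣVec n p (λ v → ΣMat n p k (λ B → g (zipWith _∷_ v B)))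
      ΣMat-columns zero k ext = ext (λ ())
      ΣMat-columns (suc p) k {g} ext = begin
        ΣMat n (suc p) (suc k) g
          ≈⟨ ΣMat-unfold p (suc k) ext ⟩
        ΣVec n (suc k) (λ row → ΣMat n p (suc k) (λ B → g (row ∷ B)))
          ≈⟨ ΣVec-unfold k (λ {row} {row′} row≗ → Σ-cong (ΣMat-isSummation n p (suc k)) (λ B →
               ext {row ∷ B} {row′ ∷ B} (λ { zero → row≗ ; (suc i) j → ≡.refl }))) ⟩
        ΣFin R n (λ v₀ → ΣVec n k (λ r → ΣMat n p (suc k) (λ B → g ((v₀ ∷ r) ∷ B))))
          ≈⟨ Σ-cong (ΣFin-isSummation R n) (λ v₀ → Σ-cong (ΣVec-isSummation n k) (λ r →
               ΣMat-columns p k (λ {B} {B′} B≗ → ext {(v₀ ∷ r) ∷ B} {(v₀ ∷ r) ∷ B′}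
                 (λ { zero j → ≡.refl ; (suc i) → B≗ i })))) ⟩
        ΣFin R n (λ v₀ → ΣVec n k (λ r → ΣVec n p (λ v → ΣMat n p k (λ B → g ((v₀ ∷ r) ∷ zipWith _∷_ v B)))))
          ≈⟨ Σ-cong (ΣFin-isSummation R n) (λ v₀ → ΣVec-swap n k (ΣVec-isSummation n p) _) ⟩
        ΣFin R n (λ v₀ → ΣVec n p (λ v → ΣVec n k (λ r → ΣMat n p k (λ B → g ((v₀ ∷ r) ∷ zipWith _∷_ v B)))))
          ≈⟨ Σ-cong (ΣFin-isSummation R n) (λ v₀ → Σ-cong (ΣVec-isSummation n p) (λ v →
               Σ-cong (ΣVec-isSummation n k) (λ r → Σ-cong (ΣMat-isSummation n p k) (λ B →
                 ext {(v₀ ∷ r) ∷ zipWith _∷_ v B} {zipWith _∷_ (v₀ ∷ v) (r ∷ B)}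
                   (λ { zero zero → ≡.refl ; zero (suc j) → ≡.refl
                      ; (suc i) zero → ≡.refl ; (suc i) (suc j) → ≡.refl }))))) ⟩
        ΣFin R n (λ v₀ → ΣVec n p (λ v → ΣVec n k (λ r → ΣMat n p k (λ B → g (zipWith _∷_ (v₀ ∷ v) (r ∷ B))))))
          ≈⟨ Σ-cong (ΣFin-isSummation R n) (λ v₀ → Σ-cong (ΣVec-isSummation n p) (λ v →
               ΣMat-unfold p k (λ {B} {B′} B≗ → ext {zipWith _∷_ (v₀ ∷ v) B} {zipWith _∷_ (v₀ ∷ v) B′}
                 (λ { i zero → ≡.refl ; i (suc j) → B≗ i j })))) ⟨
        ΣFin R n (λ v₀ → ΣVec n p (λ v → ΣMat n (suc p) k (λ B → g (zipWith _∷_ (v₀ ∷ v) B))))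
          ≈⟨ ΣVec-unfold p (λ {v} {v′} v≗ → Σ-cong (ΣMat-isSummation n (suc p) k) (λ B →
               ext {zipWith _∷_ v B} {zipWith _∷_ v′ B} (λ { i zero → v≗ i ; i (suc j) → ≡.refl }))) ⟨
        ΣVec n (suc p) (λ v → ΣMat n (suc p) k (λ B → g (zipWith _∷_ v B))) ∎

module Determinant where

  open import Data.Nat as ℕ using (ℕ; zero; suc)
  open import Data.Fin using (Fin; zero; suc; toℕ; punchIn)
  import Data.Fin.Properties as Fin
  open import Data.Integer as ℤ using (ℤ; +_; 0ℤ; 1ℤ; -1ℤ; _+_; _*_; -_; _-_)
  import Data.Integer.Properties as ℤ
  open import Data.Integer.Tactic.RingSolver using (solve-∀)
  open import Data.Vec.Functional using (_∷_)
  open import Data.Sum using (inj₂)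
  open import Data.Empty using (⊥-elim)
  open import Function using (_∘_)
  open import Relation.Binary.PropositionalEquality
  open ≡-Reasoning

  sumℤ-cong : ∀ k {f g : Fin k → ℤ} → f ≗ g → sumℤ k f ≡ sumℤ k g
  sumℤ-cong zero f≗g = refl
  sumℤ-cong (suc k) f≗g = cong₂ _+_ (f≗g zero) (sumℤ-cong k (f≗g ∘ suc))

  sumℤ-zero : ∀ k {f : Fin k → ℤ} → (∀ i → f i ≡ 0ℤ) → sumℤ k f ≡ 0ℤ
  sumℤ-zero zero f≡0 = refl
  sumℤ-zero (suc k) f≡0 = cong₂ _+_ (f≡0 zero) (sumℤ-zero k (f≡0 ∘ suc))

  sumℤ-+ : ∀ k (f g : Fin k → ℤ) → sumℤ k (λ i → f i + g i) ≡ sumℤ k f + sumℤ k g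
  sumℤ-+ zero f g = refl
  sumℤ-+ (suc k) f g = trans (cong (_+_ (f zero + g zero)) (sumℤ-+ k _ _)) (interchange (f zero) (g zero) _ _)
    where interchange : ∀ a b c d → (a + b) + (c + d) ≡ (a + c) + (b + d)
          interchange = solve-∀

  sumℤ-*ˡ : ∀ k c (f : Fin k → ℤ) → c * sumℤ k f ≡ sumℤ k (λ i → c * f i)
  sumℤ-*ˡ zero c f = ℤ.*-zeroʳ c
  sumℤ-*ˡ (suc k) c f = trans (ℤ.*-distribˡ-+ c (f zero) _) (cong (_+_ (c * f zero)) (sumℤ-*ˡ k c _))

  sumℤ-neg : ∀ k (f : Fin k → ℤ) → - sumℤ k f ≡ sumℤ k (λ i → - f i)
  sumℤ-neg k f = trans (sym (ℤ.-1*i≡-i _)) (trans (sumℤ-*ˡ k -1ℤ f) (sumℤ-cong k (ℤ.-1*i≡-i ∘ f)))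

  sumℤ-swap : ∀ a b (f : Fin a → Fin b → ℤ) →
              sumℤ a (λ i → sumℤ b (f i)) ≡ sumℤ b (λ j → sumℤ a (λ i → f i j))
  sumℤ-swap zero b f = sym (sumℤ-zero b (λ _ → refl))
  sumℤ-swap (suc a) b f = trans (cong (_+_ (sumℤ b (f zero))) (sumℤ-swap a b (f ∘ suc)))
                                (sym (sumℤ-+ b (f zero) _))

  sumℤ-punchIn : ∀ k (f : Fin (suc k) → ℤ) j → sumℤ k (f ∘ punchIn j) ≡ sumℤ (suc k) f - f j
  sumℤ-punchIn k f zero = sym (cancel (f zero) _)
    where cancel : ∀ a b → (a + b) - a ≡ b
          cancel = solve-∀
  sumℤ-punchIn (suc k) f (suc j) = trans (cong (_+_ (f zero)) (sumℤ-punchIn k (f ∘ suc) j)) (assoc (f zero) _ _)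
    where assoc : ∀ a b c → a + (b - c) ≡ (a + b) - c
          assoc = solve-∀

  sumℤ-offDiagonal : ∀ k (f : Fin (suc k) → Fin (suc k) → ℤ) →
    sumℤ (suc k) (λ j → sumℤ k (f j ∘ punchIn j)) ≡
    sumℤ (suc k) (λ j → sumℤ (suc k) (f j)) - sumℤ (suc k) (λ j → f j j)
  sumℤ-offDiagonal k f = trans (sumℤ-cong (suc k) (λ j → sumℤ-punchIn k (f j) j))
                                     (sumℤ-minus (suc k) (λ j → sumℤ (suc k) (f j)) (λ j → f j j))
    where
    sumℤ-minus : ∀ k (a b : Fin k → ℤ) → sumℤ k (λ i → a i - b i) ≡ sumℤ k a - sumℤ k b
    sumℤ-minus k a b = trans (sumℤ-+ k a (-_ ∘ b)) (cong (_+_ (sumℤ k a)) (sym (sumℤ-neg k b)))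

  sumℤ-offDiagonalᵀ : ∀ k (f : Fin (suc k) → Fin (suc k) → ℤ) →
    sumℤ (suc k) (λ j → sumℤ k (λ l → f (punchIn j l) j)) ≡
    sumℤ (suc k) (λ j → sumℤ (suc k) (f j)) - sumℤ (suc k) (λ j → f j j)
  sumℤ-offDiagonalᵀ k f = begin
    sumℤ (suc k) (λ j → sumℤ k (λ l → f (punchIn j l) j))
      ≡⟨ sumℤ-offDiagonal k (λ j i → f i j) ⟩
    sumℤ (suc k) (λ j → sumℤ (suc k) (λ i → f i j)) - sumℤ (suc k) (λ j → f j j)
      ≡⟨ cong (_- sumℤ (suc k) (λ j → f j j)) (sumℤ-swap (suc k) (suc k) f) ⟨
    sumℤ (suc k) (λ j → sumℤ (suc k) (f j)) - sumℤ (suc k) (λ j → f j j) ∎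

  altSign : ℕ → ℤ
  altSign t = -1ℤ ℤ.^ t

  Matℤ : ℕ → Set
  Matℤ r = Fin r → Fin r → ℤ

  detℤ-cong : ∀ r {M N : Matℤ r} → (∀ i → M i ≗ N i) → detℤ r M ≡ detℤ r N
  detℤ-cong zero M≗N = refl
  detℤ-cong (suc r) M≗N = sumℤ-cong (suc r) (λ j →
    cong₂ (λ a d → altSign (toℕ j) * a * d) (M≗N zero j) (detℤ-cong r (λ i k → M≗N (suc i) (punchIn j k))))

  detℤ-zero-column : ∀ r (M : Matℤ (suc r)) → (∀ i → M i zero ≡ 0ℤ) → detℤ (suc r) M ≡ 0ℤ
  detℤ-zero-column zero M col≡0 = cong (λ a → 1ℤ * a * 1ℤ + 0ℤ) (col≡0 zero)
  detℤ-zero-column (suc r) M col≡0 =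
    sumℤ-zero (suc (suc r)) {λ j → altSign (toℕ j) * M zero j * detℤ (suc r) (minor M j)} λ
    { zero    → cong (λ a → 1ℤ * a * detℤ (suc r) (minor M zero)) (col≡0 zero)
    ; (suc j) → trans (cong (_*_ (altSign (toℕ (suc j)) * M zero (suc j)))
                            (detℤ-zero-column r (minor M (suc j)) (col≡0 ∘ suc)))
                      (ℤ.*-zeroʳ (altSign (toℕ (suc j)) * M zero (suc j))) }

  -- punchOut without its i ≢ j argument; the junk value at i ≡ j is never used.
  punchOut′ : ∀ {r} → Fin (suc (suc r)) → Fin (suc (suc r)) → Fin (suc r)
  punchOut′ zero zero = zero
  punchOut′ zero (suc k) = k
  punchOut′ (suc j) zero = zero
  punchOut′ {zero} (suc j) (suc k) = zero
  punchOut′ {suc r} (suc j) (suc k) = suc (punchOut′ j k)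

  punchOut′-punchIn : ∀ {r} (j : Fin (suc (suc r))) l → punchOut′ j (punchIn j l) ≡ l
  punchOut′-punchIn zero l = refl
  punchOut′-punchIn (suc j) zero = refl
  punchOut′-punchIn {suc r} (suc j) (suc l) = cong suc (punchOut′-punchIn j l)

  punchIn-punchOut′-comm : ∀ {r} (j k : Fin (suc (suc r))) → j ≢ k → ∀ (m : Fin r) →
    punchIn j (punchIn (punchOut′ j k) m) ≡ punchIn k (punchIn (punchOut′ k j) m)
  punchIn-punchOut′-comm zero zero j≢k m = ⊥-elim (j≢k refl)
  punchIn-punchOut′-comm zero (suc k) j≢k m = refl
  punchIn-punchOut′-comm (suc j) zero j≢k m = refl
  punchIn-punchOut′-comm {zero} (suc zero) (suc zero) j≢k m = ⊥-elim (j≢k refl)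
  punchIn-punchOut′-comm {suc r} (suc j) (suc k) j≢k zero = refl
  punchIn-punchOut′-comm {suc r} (suc j) (suc k) j≢k (suc m) =
    cong suc (punchIn-punchOut′-comm j k (j≢k ∘ cong suc) m)

  altSign-punchOut′ : ∀ {r} (j k : Fin (suc (suc r))) → j ≢ k →
    altSign (toℕ j) * altSign (toℕ (punchOut′ j k)) ≡ - (altSign (toℕ k) * altSign (toℕ (punchOut′ k j)))
  altSign-punchOut′ zero zero j≢k = ⊥-elim (j≢k refl)
  altSign-punchOut′ zero (suc k) j≢k = eq (altSign (toℕ k))
    where eq : ∀ a → 1ℤ * a ≡ - ((-1ℤ * a) * 1ℤ)
          eq = solve-∀
  altSign-punchOut′ (suc j) zero j≢k = eq (altSign (toℕ j))
    where eq : ∀ a → (-1ℤ * a) * 1ℤ ≡ - (1ℤ * a)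
          eq = solve-∀
  altSign-punchOut′ {zero} (suc zero) (suc zero) j≢k = ⊥-elim (j≢k refl)
  altSign-punchOut′ {suc r} (suc j) (suc k) j≢k = begin
    (-1ℤ * altSign (toℕ j)) * (-1ℤ * altSign (toℕ (punchOut′ j k)))
      ≡⟨ eq (altSign (toℕ j)) (altSign (toℕ (punchOut′ j k))) ⟩
    altSign (toℕ j) * altSign (toℕ (punchOut′ j k))
      ≡⟨ altSign-punchOut′ j k (j≢k ∘ cong suc) ⟩
    - (altSign (toℕ k) * altSign (toℕ (punchOut′ k j)))
      ≡⟨ cong -_ (eq (altSign (toℕ k)) (altSign (toℕ (punchOut′ k j)))) ⟨
    - ((-1ℤ * altSign (toℕ k)) * (-1ℤ * altSign (toℕ (punchOut′ k j)))) ∎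
    where eq : ∀ a b → (-1ℤ * a) * (-1ℤ * b) ≡ a * b
          eq = solve-∀

  module _ {r : ℕ} where

    -- Term of the Laplace expansion along rows 0 and 1 (column j in row 0, column k in row 1),
    -- written through punchOut′ j k so that swapping the two rows exchanges j and k.
    laplace₂ : Matℤ (suc (suc r)) → Fin (suc (suc r)) → Fin (suc (suc r)) → ℤ
    laplace₂ M j k = (altSign (toℕ j) * altSign (toℕ (punchOut′ j k))) * (M zero j * M (suc zero) k)
                     * detℤ r (λ i m → M (suc (suc i)) (punchIn j (punchIn (punchOut′ j k) m)))

    detℤ-laplace₂ : ∀ M →
      detℤ (suc (suc r)) M ≡ sumℤ (suc (suc r)) (λ j → sumℤ (suc r) (laplace₂ M j ∘ punchIn j))
    detℤ-laplace₂ M = sumℤ-cong (suc (suc r)) (λ j →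
      trans (sumℤ-*ˡ (suc r) (altSign (toℕ j) * M zero j)
                     (λ l → altSign (toℕ l) * M (suc zero) (punchIn j l) * detℤ r (minor (minor M j) l)))
            (sumℤ-cong (suc r) (λ l →
        trans (eq (altSign (toℕ j)) (altSign (toℕ l)) (M zero j) (M (suc zero) (punchIn j l))
                  (detℤ r (minor (minor M j) l)))
              (cong (λ l′ → (altSign (toℕ j) * altSign (toℕ l′)) * (M zero j * M (suc zero) (punchIn j l))
                            * detℤ r (λ i m → M (suc (suc i)) (punchIn j (punchIn l′ m))))
                    (sym (punchOut′-punchIn j l))))))
      where eq : ∀ a b x y d → a * x * (b * y * d) ≡ (a * b) * (x * y) * d
            eq = solve-∀

    swap₀₁ : Fin (suc (suc r)) → Fin (suc (suc r))
    swap₀₁ zero = suc zero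
    swap₀₁ (suc zero) = zero
    swap₀₁ (suc (suc i)) = suc (suc i)

    laplace₂-swap₀₁ : ∀ M j k → j ≢ k → laplace₂ (M ∘ swap₀₁) j k ≡ - laplace₂ M k j
    laplace₂-swap₀₁ M j k j≢k = begin
      (altSign (toℕ j) * altSign (toℕ (punchOut′ j k))) * (M (suc zero) j * M zero k)
        * detℤ r (λ i m → M (suc (suc i)) (punchIn j (punchIn (punchOut′ j k) m)))
        ≡⟨ cong₂ (λ s d → s * (M (suc zero) j * M zero k) * d) (altSign-punchOut′ j k j≢k)
                 (detℤ-cong r (λ i m → cong (M (suc (suc i))) (punchIn-punchOut′-comm j k j≢k m))) ⟩
      (- (altSign (toℕ k) * altSign (toℕ (punchOut′ k j)))) * (M (suc zero) j * M zero k)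
        * detℤ r (λ i m → M (suc (suc i)) (punchIn k (punchIn (punchOut′ k j) m)))
        ≡⟨ eq (altSign (toℕ k) * altSign (toℕ (punchOut′ k j))) (M zero k) (M (suc zero) j)
              (detℤ r (λ i m → M (suc (suc i)) (punchIn k (punchIn (punchOut′ k j) m)))) ⟩
      - laplace₂ M k j ∎
      where eq : ∀ s x y d → (- s) * (y * x) * d ≡ - (s * (x * y) * d)
            eq = solve-∀

    detℤ-swap₀₁ : ∀ M → detℤ (suc (suc r)) (M ∘ swap₀₁) ≡ - detℤ (suc (suc r)) M
    detℤ-swap₀₁ M = begin
      detℤ (suc (suc r)) (M ∘ swap₀₁)
        ≡⟨ detℤ-laplace₂ (M ∘ swap₀₁) ⟩
      sumℤ (suc (suc r)) (λ j → sumℤ (suc r) (laplace₂ (M ∘ swap₀₁) j ∘ punchIn j))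
        ≡⟨ sumℤ-cong (suc (suc r)) (λ j → sumℤ-cong (suc r) (λ l →
             laplace₂-swap₀₁ M j (punchIn j l) (Fin.punchInᵢ≢i j l ∘ sym))) ⟩
      sumℤ (suc (suc r)) (λ j → sumℤ (suc r) (λ l → - laplace₂ M (punchIn j l) j))
        ≡⟨ trans (sumℤ-neg (suc (suc r)) (λ j → sumℤ (suc r) (λ l → laplace₂ M (punchIn j l) j)))
                 (sumℤ-cong (suc (suc r)) (λ j → sumℤ-neg (suc r) (λ l → laplace₂ M (punchIn j l) j))) ⟨
      - sumℤ (suc (suc r)) (λ j → sumℤ (suc r) (λ l → laplace₂ M (punchIn j l) j))
        ≡⟨ cong -_ (trans (sumℤ-offDiagonalᵀ (suc r) (laplace₂ M))
                          (sym (sumℤ-offDiagonal (suc r) (laplace₂ M)))) ⟩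
      - sumℤ (suc (suc r)) (λ j → sumℤ (suc r) (laplace₂ M j ∘ punchIn j))
        ≡⟨ cong -_ (detℤ-laplace₂ M) ⟨
      - detℤ (suc (suc r)) M ∎

  i≡-i⇒i≡0 : ∀ i → i ≡ - i → i ≡ 0ℤ
  i≡-i⇒i≡0 i i≡-i
    with ℤ.i*j≡0⇒i≡0∨j≡0 (+ 2) (trans (double i) (trans (cong (_+_ i) i≡-i) (ℤ.+-inverseʳ i)))
    where double : ∀ i → + 2 * i ≡ i + i
          double = solve-∀
  ... | inj₂ i≡0 = i≡0

  mutual
    detℤ-equalRows : ∀ r (M : Matℤ r) {p q} → p ≢ q → M p ≗ M q → detℤ r M ≡ 0ℤ
    detℤ-equalRows (suc r) M {zero} {zero} p≢q _ = ⊥-elim (p≢q refl)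
    detℤ-equalRows (suc r) M {zero} {suc q} _ Mp≗Mq = detℤ-equalRows₀ r M q Mp≗Mq
    detℤ-equalRows (suc r) M {suc p} {zero} _ Mp≗Mq = detℤ-equalRows₀ r M p (sym ∘ Mp≗Mq)
    detℤ-equalRows (suc r) M {suc p} {suc q} p≢q Mp≗Mq = detℤ-equalRowsₛ r M (p≢q ∘ cong suc) Mp≗Mq

    detℤ-equalRowsₛ : ∀ r (M : Matℤ (suc r)) {p q} → p ≢ q → M (suc p) ≗ M (suc q) →
                      detℤ (suc r) M ≡ 0ℤ
    detℤ-equalRowsₛ r M p≢q Mp≗Mq =
      sumℤ-zero (suc r) {λ j → altSign (toℕ j) * M zero j * detℤ r (minor M j)} (λ j →
        trans (cong (altSign (toℕ j) * M zero j *_) (detℤ-equalRows r (minor M j) p≢q (Mp≗Mq ∘ punchIn j)))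
              (ℤ.*-zeroʳ (altSign (toℕ j) * M zero j)))

    detℤ-equalRows₀ : ∀ r (M : Matℤ (suc r)) q → M zero ≗ M (suc q) → detℤ (suc r) M ≡ 0ℤ
    detℤ-equalRows₀ (suc r) M zero M₀≗Mq =
      i≡-i⇒i≡0 _ (trans (sym (detℤ-cong (suc (suc r)) swapped≗M)) (detℤ-swap₀₁ M))
      where
      swapped≗M : ∀ i → M (swap₀₁ i) ≗ M i
      swapped≗M zero = sym ∘ M₀≗Mq
      swapped≗M (suc zero) = M₀≗Mq
      swapped≗M (suc (suc i)) _ = refl
    detℤ-equalRows₀ (suc r) M (suc q) M₀≗Mq = begin
      detℤ (suc (suc r)) M              ≡⟨ ℤ.neg-involutive _ ⟨
      - - detℤ (suc (suc r)) M          ≡⟨ cong -_ (detℤ-swap₀₁ M) ⟨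
      - detℤ (suc (suc r)) (M ∘ swap₀₁) ≡⟨ cong -_ (detℤ-equalRowsₛ (suc r) (M ∘ swap₀₁) {zero} {suc q}
                                                                     (λ ()) M₀≗Mq) ⟩
      - 0ℤ                              ∎

  cofactor : ∀ {r} → (Fin r → Fin (suc r) → ℤ) → Fin (suc r) → ℤ
  cofactor {r} B j = altSign (toℕ j) * detℤ r (λ i k → B i (punchIn j k))

  cofactor-cong : ∀ {r} {B B′ : Fin r → Fin (suc r) → ℤ} → (∀ i → B i ≗ B′ i) →
                  cofactor B ≗ cofactor B′
  cofactor-cong {r} B≗B′ j = cong (altSign (toℕ j) *_) (detℤ-cong r (λ i k → B≗B′ i (punchIn j k)))

  detℤ-expand : ∀ r (x : Fin (suc r) → ℤ) B →
                detℤ (suc r) (x ∷ B) ≡ sumℤ (suc r) (λ j → x j * cofactor B j)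
  detℤ-expand r x B =
    sumℤ-cong (suc r) (λ j → comm (altSign (toℕ j)) (x j) (detℤ r (λ i k → B i (punchIn j k))))
    where comm : ∀ s a d → s * a * d ≡ a * (s * d)
          comm = solve-∀

module ModularLinearAlgebra (m : ℕ) where

  open import Data.Nat as ℕ using (zero; suc)
  import Data.Nat.Properties as ℕ
  import Data.Nat.DivMod as ℕ
  import Data.Nat.Divisibility as ℕ
  open import Data.Nat.Coprimality as Coprimality using (coprime-divisor; gcd≡1⇒coprime)
  open import Data.Nat.GCD using (gcd)
  open import Data.Fin using (Fin; zero; suc; toℕ; punchIn)
  import Data.Fin.Properties as Fin
  open import Data.Integer as ℤ using (ℤ; +_; 0ℤ)
  import Data.Integer.Properties as ℤ
  open import Data.Integer.DivMod using (_%ℕ_)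
  open import Data.Integer.Tactic.RingSolver using (solve-∀)
  open import Data.Vec.Functional using (_∷_; updateAt; zipWith)
  open import Function using (_∘_)
  open import Relation.Nullary using (Dec)
  open import Relation.Binary.PropositionalEquality as ≡ using (_≡_; _≗_)
  open Congruence
  open VectorSums
  open Determinant

  private
    n : ℕ
    n = suc m

  infix 4 _≟ₙ_
  _≟ₙ_ : (L : ℤ) (d : ℕ) → Dec (L %ℕ n ≡ d ℕ.% n)
  L ≟ₙ d = L %ℕ n ℕ.≟ d ℕ.% n

  +toℕ-translate : ∀ a y → + toℕ (translate a y) ≡ + toℕ y ℤ.+ + a mod n
  +toℕ-translate a y = ≡-mod-trans (≡⇒≡-mod (≡.cong +_ (toℕ-mod (toℕ y ℕ.+ a) n)))
    (≡-mod-trans (≡-mod-sym (≡-mod-%ℕ (+ (toℕ y ℕ.+ a)))) (≡⇒≡-mod (ℤ.pos-+ (toℕ y) a)))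

  infixl 7 _·_
  _·_ : ∀ {k} → (Fin k → Fin n) → (Fin k → ℤ) → ℤ
  _·_ {k} x c = sumℤ k (λ j → + toℕ (x j) ℤ.* c j)

  ·-congˡ : ∀ {k} {x y : Fin k → Fin n} c → x ≗ y → x · c ≡ y · c
  ·-congˡ {k} c x≗y = sumℤ-cong k (λ j → ≡.cong (λ t → + toℕ t ℤ.* c j) (x≗y j))

  ·-congʳ : ∀ {k} (x : Fin k → Fin n) {c c′} → c ≗ c′ → x · c ≡ x · c′
  ·-congʳ {k} x c≗c′ = sumℤ-cong k (λ j → ≡.cong (+ toℕ (x j) ℤ.*_) (c≗c′ j))

  ·-≡0 : ∀ {k} (x : Fin k → Fin n) {c} → (∀ j → c j ≡ 0ℤ mod n) → x · c ≡ 0ℤ mod n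
  ·-≡0 {zero} x c≡0 = ≡-mod-refl
  ·-≡0 {suc k} x c≡0 = ≡-mod-trans (+-cong-mod (*-cong-mod (≡-mod-refl {x = + toℕ (x zero)}) (c≡0 zero))
                                                (·-≡0 (x ∘ suc) (c≡0 ∘ suc)))
                                    (≡⇒≡-mod (≡.cong (ℤ._+ 0ℤ) (ℤ.*-zeroʳ (+ toℕ (x zero)))))

  ·-updateAt : ∀ {k} (j : Fin k) a x c → updateAt x j (translate a) · c ≡ x · c ℤ.+ + a ℤ.* c j mod n
  ·-updateAt zero a x c =
    ≡-mod-trans (+-cong-mod (*-cong-mod (+toℕ-translate a (x zero)) (≡-mod-refl {x = c zero})) ≡-mod-refl)
                (≡⇒≡-mod (eq (+ toℕ (x zero)) (+ a) (c zero) ((x ∘ suc) · (c ∘ suc))))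
    where eq : ∀ y a c L → (y ℤ.+ a) ℤ.* c ℤ.+ L ≡ y ℤ.* c ℤ.+ L ℤ.+ a ℤ.* c
          eq = solve-∀
  ·-updateAt (suc j) a x c =
    ≡-mod-trans (+-cong-mod (≡-mod-refl {x = + toℕ (x zero) ℤ.* c zero}) (·-updateAt j a (x ∘ suc) (c ∘ suc)))
                (≡⇒≡-mod (≡.sym (ℤ.+-assoc (+ toℕ (x zero) ℤ.* c zero) _ _)))

  cofactors : ∀ {r} → (Fin r → Fin r → Fin n) → (Fin r → Fin n) → Fin (suc r) → ℤ
  cofactors B v = cofactor ⟦ zipWith _∷_ v B ⟧

  Degenerate : ∀ {r} → (Fin (suc r) → ℤ) → Set
  Degenerate c = ∀ j → c (suc j) %ℕ n ≡ 0

  cofactors-zero : ∀ {r} (B : Fin r → Fin r → Fin n) v → cofactors B v zero ≡ detℤ r ⟦ B ⟧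
  cofactors-zero B v = ℤ.*-identityˡ _

  cofactors-origin : ∀ {r} (B : Fin r → Fin r → Fin n) → Degenerate (cofactors B (λ _ → zero))
  cofactors-origin {suc r} B j = ≡.cong (_%ℕ n) (≡.trans
    (≡.cong (altSign (toℕ (suc j)) ℤ.*_)
            (detℤ-zero-column r (λ i k → ⟦ zipWith _∷_ (λ _ → zero) B ⟧ i (punchIn (suc j) k))
                                (λ _ → ≡.refl)))
    (ℤ.*-zeroʳ (altSign (toℕ (suc j)))))

  -- Putting row i of (v | B) on top gives a singular matrix, whose first-row expansion is
  -- v_i det B mod n.
  cramer : ∀ {r} (B : Fin r → Fin r → Fin n) → gcd (detℤ r ⟦ B ⟧ %ℕ n) n ≡ 1 →
           ∀ v → Degenerate (cofactors B v) → v ≗ (λ _ → zero)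
  cramer {r} B coprime v degenerate i =
    Fin.toℕ-injective (<-mod-unique (Fin.toℕ<n (v i)) ℕ.z<s (∣⇒≡0-mod n∣vᵢ))
    where
    M = ⟦ zipWith _∷_ v B ⟧
    u = detℤ r ⟦ B ⟧ %ℕ n
    expansion : detℤ (suc r) (M i ∷ M) ≡ zipWith _∷_ v B i · cofactors B v
    expansion = detℤ-expand r (M i) M
    vᵢdet≡expansion : + toℕ (v i) ℤ.* detℤ r ⟦ B ⟧ ≡ zipWith _∷_ v B i · cofactors B v mod n
    vᵢdet≡expansion = ≡-mod-sym (≡-mod-trans
      (+-cong-mod (≡⇒≡-mod (≡.cong (+ toℕ (v i) ℤ.*_) (cofactors-zero B v)))
                  (·-≡0 (B i) (λ j → %ℕ≡⇒≡-mod (degenerate j))))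
      (≡⇒≡-mod (ℤ.+-identityʳ _)))
    vᵢdet≡0 : + toℕ (v i) ℤ.* detℤ r ⟦ B ⟧ ≡ 0ℤ mod n
    vᵢdet≡0 = ≡-mod-trans vᵢdet≡expansion (≡⇒≡-mod (≡.trans (≡.sym expansion)
      (detℤ-equalRows (suc r) (M i ∷ M) {zero} {suc i} (λ ()) (λ _ → ≡.refl))))
    n∣vᵢu : n ℕ.∣ toℕ (v i) ℕ.* u
    n∣vᵢu = ≡0-mod⇒∣ (≡-mod-trans (≡⇒≡-mod (ℤ.pos-* (toℕ (v i)) u))
      (≡-mod-trans (*-cong-mod (≡-mod-refl {x = + toℕ (v i)}) (≡-mod-sym (≡-mod-%ℕ (detℤ r ⟦ B ⟧))))
                   vᵢdet≡0))
    n∣vᵢ : n ℕ.∣ toℕ (v i)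
    n∣vᵢ = coprime-divisor (Coprimality.sym (gcd≡1⇒coprime {u} {n} coprime))
                           (≡.subst (n ℕ.∣_) (ℕ.*-comm (toℕ (v i)) u) n∣vᵢu)

module CharacterSums {c ℓ} (R : CommutativeRing c ℓ) (domain : IsIntegralDomain R) (m : ℕ)
         (ζ : CommutativeRing.Carrier R) (ζ-primitive : IsPrimitiveRoot R (suc m) ζ)
         (α : ℕ) (α-coprime : Coprime (suc m) α) where

  open import Data.Nat as ℕ using (zero; suc)
  import Data.Nat.Properties as ℕ
  import Data.Nat.DivMod as ℕ
  import Data.Nat.Divisibility as ℕ
  open import Data.Nat.Coprimality using (coprime-divisor)
  open import Data.Nat.GCD using (gcd; gcd[m,n]∣m; gcd[m,n]∣n; gcd[m,n]≢0)
  open import Data.Fin using (Fin; zero; suc; toℕ)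
  open import Data.Integer as ℤ using (ℤ; +_; 0ℤ)
  import Data.Integer.Properties as ℤ
  open import Data.Integer.DivMod using (_%ℕ_; n%ℕd<d)
  open import Data.Integer.Tactic.RingSolver using (solve-∀)
  open import Data.Product using (proj₁; proj₂)
  open import Data.Sum using (inj₂)
  open import Data.Vec.Functional using (_∷_; updateAt)
  open import Function using (_∘_)
  open import Relation.Nullary using (¬_; yes; no)
  open import Relation.Binary.PropositionalEquality as ≡ using (_≡_; _≢_; _≗_)
  open NatLemmas
  open Congruence
  open RingLemmas
  open Summation
  open VectorSums

  open ModularLinearAlgebra m

  open CommutativeRing R hiding (zero)
  open import Relation.Binary.Reasoning.Setoid setoid

  private
    n : ℕ
    n = suc m

  ψ : ℕ → Carrier
  ψ y = pow R ζ (α ℕ.* y)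

  ψ-+ : ∀ a b → ψ (a ℕ.+ b) ≈ ψ a * ψ b
  ψ-+ a b = trans (reflexive (≡.cong (pow R ζ) (ℕ.*-distribˡ-+ α a b))) (pow-+ R ζ (α ℕ.* a) (α ℕ.* b))

  ψ-cong-% : ∀ {a b} → a ℕ.% n ≡ b ℕ.% n → ψ a ≈ ψ b
  ψ-cong-% {a} {b} a≡b = begin
    ψ a                                      ≈⟨ pow-% R n (proj₁ ζ-primitive) (α ℕ.* a) ⟩
    pow R ζ ((α ℕ.* a) ℕ.% n)                ≡⟨ ≡.cong (pow R ζ) (ℕ.%-distribˡ-* α a n) ⟩
    pow R ζ ((α ℕ.% n ℕ.* (a ℕ.% n)) ℕ.% n)  ≡⟨ ≡.cong (λ t → pow R ζ ((α ℕ.% n ℕ.* t) ℕ.% n)) a≡b ⟩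
    pow R ζ ((α ℕ.% n ℕ.* (b ℕ.% n)) ℕ.% n)  ≡⟨ ≡.cong (pow R ζ) (ℕ.%-distribˡ-* α b n) ⟨
    pow R ζ ((α ℕ.* b) ℕ.% n)                ≈⟨ pow-% R n (proj₁ ζ-primitive) (α ℕ.* b) ⟨
    ψ b                                      ∎

  ψ-translate : ∀ k x → ψ (toℕ (translate k x)) ≈ ψ (toℕ x) * ψ k
  ψ-translate k x = trans (ψ-cong-% (≡.trans (≡.cong (ℕ._% n) (toℕ-mod (toℕ x ℕ.+ k) n))
                                             (ℕ.m%n%n≡m%n (toℕ x ℕ.+ k) n)))
                          (ψ-+ (toℕ x) k)

  ψ≉1 : ∀ {k} → k ℕ.% n ≢ 0 → ¬ (ψ k ≈ 1#)
  ψ≉1 {k} k≢0 ψk≈1 with (α ℕ.* k) ℕ.% n ℕ.≟ 0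
  ... | yes αk≡0 =
    k≢0 (ℕ.n∣m⇒m%n≡0 k n (coprime-divisor α-coprime (ℕ.m%n≡0⇒n∣m (α ℕ.* k) n αk≡0)))
  ... | no αk≢0 = proj₂ ζ-primitive ((α ℕ.* k) ℕ.% n) (ℕ.n≢0⇒n>0 αk≢0) (ℕ.m%n<n (α ℕ.* k) n)
                                  (trans (sym (pow-% R n (proj₁ ζ-primitive) (α ℕ.* k))) ψk≈1)

  when-≟ₙ-cong : ∀ {L L′} d {x y} → L ≡ L′ mod n → x ≈ y →
                 when R (L ≟ₙ d) x ≈ when R (L′ ≟ₙ d) y
  when-≟ₙ-cong {L} {L′} d L≡L′ = when-cong R (L ≟ₙ d) (L′ ≟ₙ d)
    (≡.trans (≡.sym (≡-mod⇒%ℕ≡ L≡L′))) (≡.trans (≡-mod⇒%ℕ≡ L≡L′))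

  Φ : ℕ → ℤ → Carrier
  Φ d c = ΣFin R n (λ x → when R (+ toℕ x ℤ.* c ≟ₙ d) (ψ (toℕ x)))

  Φ-cong : ∀ d {c c′} → c ≡ c′ mod n → Φ d c ≈ Φ d c′
  Φ-cong d c≡c′ = Σ-cong (ΣFin-isSummation R n) (λ x →
    when-≟ₙ-cong d (*-cong-mod (≡-mod-refl {x = + toℕ x}) c≡c′) (refl {ψ (toℕ x)}))

  -- Translating x by q = n / gcd(c, n) leaves x c unchanged mod n but multiplies ψ(x) by ψ(q) ≉ 1.
  Φ-vanishes : ∀ d c → gcd (c %ℕ n) n ≢ 1 → Φ d c ≈ 0#
  Φ-vanishes d c g≢1 = x≈wx⇒x≈0 R domain (ψ≉1 q%n≢0) (begin
    Φ d c                            ≈⟨ ΣFin-translate R n q φ ⟨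
    ΣFin R n (φ ∘ translate q)     ≈⟨ Σ-cong (ΣFin-isSummation R n) φ-translate ⟩
    ΣFin R n (λ x → ψ q * φ x)       ≈⟨ Σ-*ˡ (ΣFin-isSummation R n) (ψ q) φ ⟩
    ψ q * Φ d c                      ∎)
    where
    u = c %ℕ n
    g = gcd u n
    g∣n : g ℕ.∣ n
    g∣n = gcd[m,n]∣n u n
    q = ℕ.quotient g∣n
    instance
      g-nonTrivial : ℕ.NonTrivial g
      g-nonTrivial = ≢0∧≢1⇒nonTrivial (gcd[m,n]≢0 u n (inj₂ (λ ()))) g≢1
      q-nonZero : ℕ.NonZero q
      q-nonZero = ℕ.quotient≢0 g∣n
    q%n≢0 : q ℕ.% n ≢ 0
    q%n≢0 q%n≡0 = ℕ.≢-nonZero⁻¹ q (≡.trans (≡.sym (ℕ.m<n⇒m%n≡m (ℕ.quotient-< g∣n))) q%n≡0)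
    qc≡0 : + q ℤ.* c ≡ 0ℤ mod n
    qc≡0 = ≡-mod-trans (*-cong-mod (≡-mod-refl {x = + q}) (≡-mod-%ℕ c))
             (≡-mod-trans (≡⇒≡-mod (≡.sym (ℤ.pos-* q u))) (∣⇒≡0-mod (n∣qu)))
      where
      n∣qu : n ℕ.∣ q ℕ.* u
      n∣qu = ≡.subst (ℕ._∣ q ℕ.* u) (≡.sym (ℕ._∣_.equality g∣n)) (ℕ.*-monoʳ-∣ q (gcd[m,n]∣m u n))
    φ : Fin n → Carrier
    φ x = when R (+ toℕ x ℤ.* c ≟ₙ d) (ψ (toℕ x))
    φ-translate : ∀ x → φ (translate q x) ≈ ψ q * φ x
    φ-translate x = begin
      φ (translate q x)                              ≈⟨ when-≟ₙ-cong d xc-invariant (ψ-translate q x) ⟩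
      when R (+ toℕ x ℤ.* c ≟ₙ d) (ψ (toℕ x) * ψ q)   ≈⟨ when-*ʳ R (+ toℕ x ℤ.* c ≟ₙ d) _ _ ⟩
      φ x * ψ q                                        ≈⟨ *-comm _ _ ⟩
      ψ q * φ x                                        ∎
      where
      xc-invariant : + toℕ (translate q x) ℤ.* c ≡ + toℕ x ℤ.* c mod n
      xc-invariant = ≡-mod-trans (*-cong-mod (+toℕ-translate q x) ≡-mod-refl)
        (≡-mod-trans (≡⇒≡-mod (ℤ.*-distribʳ-+ c (+ toℕ x) (+ q)))
        (≡-mod-trans (+-cong-mod (≡-mod-refl {x = + toℕ x ℤ.* c}) qc≡0) (≡⇒≡-mod (ℤ.+-identityʳ _))))

  Ψ-term : ℕ → ∀ {k} → (Fin (suc k) → ℤ) → (Fin (suc k) → Fin n) → Carrier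
  Ψ-term d c x = when R (x · c ≟ₙ d) (ψ (toℕ (x zero)))

  Ψ : ℕ → ∀ k → (Fin (suc k) → ℤ) → Carrier
  Ψ d k c = ΣVec R n (suc k) (Ψ-term d c)

  Ψ-term-ext : ∀ d {k} (c : Fin (suc k) → ℤ) → Extensional R (Ψ-term d c)
  Ψ-term-ext d c {x} {y} x≗y =
    when-≟ₙ-cong d (≡⇒≡-mod (·-congˡ c x≗y)) (reflexive (≡.cong (ψ ∘ toℕ) (x≗y zero)))

  Ψ-cong : ∀ d k {c c′} → c ≗ c′ → Ψ d k c ≈ Ψ d k c′
  Ψ-cong d k {c} {c′} c≗c′ = Σ-cong (ΣVec-isSummation R n (suc k)) (λ x →
    when-≟ₙ-cong d (≡⇒≡-mod (·-congʳ x c≗c′)) (refl {ψ (toℕ (x zero))}))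

  Ψ-degenerate : ∀ d k c → (∀ j → c (suc j) ≡ 0ℤ mod n) → Ψ d k c ≈ fromℕ R (n ℕ.^ k) * Φ d (c zero)
  Ψ-degenerate d k c c≡0 = begin
    Ψ d k c
      ≈⟨ ΣVec-unfold R k (Ψ-term-ext d c) ⟩
    ΣFin R n (λ y → ΣVec R n k (λ x → Ψ-term d c (y ∷ x)))
      ≈⟨ Σ-cong (ΣFin-isSummation R n) (λ y → Σ-cong (ΣVec-isSummation R n k) (λ x →
           when-≟ₙ-cong d (·-tail≡0 y x) (refl {ψ (toℕ y)}))) ⟩
    ΣFin R n (λ y → ΣVec R n k (λ _ → when R (+ toℕ y ℤ.* c zero ≟ₙ d) (ψ (toℕ y))))
      ≈⟨ Σ-cong (ΣFin-isSummation R n) (λ y → ΣFun-ΣFin-const R n k (φ y)) ⟩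
    ΣFin R n (λ y → fromℕ R (n ℕ.^ k) * when R (+ toℕ y ℤ.* c zero ≟ₙ d) (ψ (toℕ y)))
      ≈⟨ Σ-*ˡ (ΣFin-isSummation R n) (fromℕ R (n ℕ.^ k)) φ ⟩
    fromℕ R (n ℕ.^ k) * Φ d (c zero) ∎
    where
    φ : Fin n → Carrier
    φ y = when R (+ toℕ y ℤ.* c zero ≟ₙ d) (ψ (toℕ y))
    ·-tail≡0 : ∀ y x → (y ∷ x) · c ≡ + toℕ y ℤ.* c zero mod n
    ·-tail≡0 y x = ≡-mod-trans (+-cong-mod (≡-mod-refl {x = + toℕ y ℤ.* c zero}) (·-≡0 x (c≡0)))
                               (≡⇒≡-mod (ℤ.+-identityʳ _))

  Ψ-vanishes : ∀ d k c (j : Fin k) → c (suc j) %ℕ n ≢ 0 → Ψ d k c ≈ 0#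
  Ψ-vanishes d k c j cⱼ≢0 = x≈wx⇒x≈0 R domain (ψ≉1 a₁%n≢0) (begin
    ΣVec R n (suc k) h
      ≈⟨ ΣVec-updateAt R (suc k) zero (translate a₁) (ΣFin-translate R n a₁) (Ψ-term-ext d c) ⟨
    ΣVec R n (suc k) (h ∘ τ₁)
      ≈⟨ ΣVec-updateAt R (suc k) (suc j) (translate a₂) (ΣFin-translate R n a₂)
                       (Ψ-term-ext d c ∘ updateAt-resp-≗ zero (translate a₁)) ⟨
    ΣVec R n (suc k) (h ∘ τ₁ ∘ τ₂)
      ≈⟨ Σ-cong (ΣVec-isSummation R n (suc k)) h-translate ⟩
    ΣVec R n (suc k) (λ x → ψ a₁ * h x)
      ≈⟨ Σ-*ˡ (ΣVec-isSummation R n (suc k)) (ψ a₁) h ⟩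
    ψ a₁ * ΣVec R n (suc k) h ∎)
    where
    a₁ = c (suc j) %ℕ n
    a₂ = ℤ.- c zero %ℕ n
    a₁%n≢0 : a₁ ℕ.% n ≢ 0
    a₁%n≢0 a₁%n≡0 = cⱼ≢0 (≡.trans (≡.sym (ℕ.m<n⇒m%n≡m (n%ℕd<d (c (suc j)) n))) a₁%n≡0)
    h = Ψ-term d c
    τ₁ τ₂ : (Fin (suc k) → Fin n) → Fin (suc k) → Fin n
    τ₁ x = updateAt x zero (translate a₁)
    τ₂ x = updateAt x (suc j) (translate a₂)
    ·-invariant : ∀ x → τ₁ (τ₂ x) · c ≡ x · c mod n
    ·-invariant x =
      ≡-mod-trans (·-updateAt zero a₁ (τ₂ x) c)
        (≡-mod-trans (+-cong-mod (·-updateAt (suc j) a₂ x c) ≡-mod-refl)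
          (≡-mod-trans (+-cong-mod (+-cong-mod (≡-mod-refl {x = x · c})
                                               (*-cong-mod (≡-mod-sym (≡-mod-%ℕ (ℤ.- c zero)))
                                                           (≡-mod-refl {x = c (suc j)})))
                                   (*-cong-mod (≡-mod-sym (≡-mod-%ℕ (c (suc j)))) (≡-mod-refl {x = c zero})))
            (≡⇒≡-mod (cancel (x · c) (c zero) (c (suc j))))))
      where cancel : ∀ L c₀ cⱼ → L ℤ.+ ℤ.- c₀ ℤ.* cⱼ ℤ.+ cⱼ ℤ.* c₀ ≡ L
            cancel = solve-∀
    h-translate : ∀ x → h (τ₁ (τ₂ x)) ≈ ψ a₁ * h x
    h-translate x = begin
      h (τ₁ (τ₂ x))                                  ≈⟨ when-≟ₙ-cong d (·-invariant x) (ψ-translate a₁ (x zero)) ⟩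
      when R (x · c ≟ₙ d) (ψ (toℕ (x zero)) * ψ a₁)  ≈⟨ when-*ʳ R (x · c ≟ₙ d) _ _ ⟩
      h x * ψ a₁                                     ≈⟨ *-comm _ _ ⟩
      ψ a₁ * h x                                     ∎

module GaussKloosterman {c ℓ} (R : CommutativeRing c ℓ) (domain : IsIntegralDomain R) (m : ℕ)
         (ζ : CommutativeRing.Carrier R) (ζ-primitive : IsPrimitiveRoot R (suc m) ζ)
         (α : ℕ) (α-coprime : Coprime (suc m) α) where

  open import Data.Nat as ℕ using (zero; suc)
  import Data.Nat.Properties as ℕ
  import Data.Nat.DivMod as ℕ
  open import Data.Nat.GCD using (gcd)
  open import Data.Nat.Combinatorics using (_C_)
  open import Data.Fin using (Fin; zero; suc; toℕ)
  import Data.Fin.Properties as Fin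
  open import Data.Integer as ℤ using (ℤ; +_)
  import Data.Integer.Properties as ℤ
  open import Data.Integer.DivMod using (_%ℕ_; n%ℕd<d)
  open import Data.Product using (_,_)
  open import Data.Vec.Functional using (_∷_; zipWith)
  open import Function using (_∘_)
  open import Relation.Nullary using (¬_; yes; no)
  open import Relation.Binary.PropositionalEquality as ≡ using (_≡_; _≢_)
  open NatLemmas
  open Congruence
  open RingLemmas
  open Summation
  open VectorSums
  open Determinant

  open ModularLinearAlgebra m
  open CharacterSums R domain m ζ ζ-primitive α α-coprime

  open CommutativeRing R hiding (zero)
  open import Relation.Binary.Reasoning.Setoid setoid

  private
    n : ℕ
    n = suc m

  Gauss : ℕ → ℕ → Carrier
  Gauss r d = ΣMat R n r r (λ X → when R (detℤ r ⟦ X ⟧ ≟ₙ d) (ψ (trℕ r X)))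

  Kloost : ℕ → ℕ → Carrier
  Kloost r d = ΣVec R n r (λ x → when R (prodℕ r x ℕ.% n ℕ.≟ d ℕ.% n) (ψ (sumℕ r x)))

  Σ-by-residue : ∀ {A : Set} {S : (A → Carrier) → Carrier} → IsSummation R S →
                 (G : ℤ → Carrier) → (∀ {c c′} → c ≡ c′ mod n → G c ≈ G c′) →
                 (val : A → ℤ) (w : A → Carrier) →
                 S (λ a → G (val a) * w a) ≈
                 ΣFin R n (λ t → G (+ toℕ t) * S (λ a → when R (val a ≟ₙ toℕ t) (w a)))
  Σ-by-residue {S = S} S-sum G G-cong val w = begin
    S (λ a → G (val a) * w a)
      ≈⟨ Σ-cong S-sum (λ a → sym (split a)) ⟩
    S (λ a → ΣFin R n (λ t → G (+ toℕ t) * when R (val a ≟ₙ toℕ t) (w a)))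
      ≈⟨ ΣFin-swap R n S-sum (λ t a → G (+ toℕ t) * when R (val a ≟ₙ toℕ t) (w a)) ⟨
    ΣFin R n (λ t → S (λ a → G (+ toℕ t) * when R (val a ≟ₙ toℕ t) (w a)))
      ≈⟨ Σ-cong (ΣFin-isSummation R n) (λ t →
           Σ-*ˡ S-sum (G (+ toℕ t)) (λ a → when R (val a ≟ₙ toℕ t) (w a))) ⟩
    ΣFin R n (λ t → G (+ toℕ t) * S (λ a → when R (val a ≟ₙ toℕ t) (w a))) ∎
    where
    split : ∀ a → ΣFin R n (λ t → G (+ toℕ t) * when R (val a ≟ₙ toℕ t) (w a)) ≈ G (val a) * w a
    split a = begin
      ΣFin R n (λ t → G (+ toℕ t) * when R (val a ≟ₙ toℕ t) (w a))
        ≈⟨ ΣFin-δ R n (λ t → G (+ toℕ t) * when R (val a ≟ₙ toℕ t) (w a)) t₀ off ⟩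
      G (+ toℕ t₀) * when R (val a ≟ₙ toℕ t₀) (w a)
        ≈⟨ *-cong (G-cong t₀≡val) (when-yes R (val a ≟ₙ toℕ t₀) (w a) on) ⟩
      G (val a) * w a ∎
      where
      t₀ : Fin n
      t₀ = Data.Fin.fromℕ< (n%ℕd<d (val a) n)
      toℕ-t₀ : toℕ t₀ ≡ val a %ℕ n
      toℕ-t₀ = Fin.toℕ-fromℕ< (n%ℕd<d (val a) n)
      t₀≡val : + toℕ t₀ ≡ val a mod n
      t₀≡val = ≡-mod-trans (≡⇒≡-mod (≡.cong +_ toℕ-t₀)) (≡-mod-sym (≡-mod-%ℕ (val a)))
      on : val a %ℕ n ≡ toℕ t₀ ℕ.% n
      on = ≡.trans (≡.sym toℕ-t₀) (≡.sym (ℕ.m<n⇒m%n≡m (Fin.toℕ<n t₀)))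
      off : ∀ t → t ≢ t₀ → G (+ toℕ t) * when R (val a ≟ₙ toℕ t) (w a) ≈ 0#
      off t t≢t₀ = trans (*-congˡ (when-no R (val a ≟ₙ toℕ t) (w a) (λ e → t≢t₀ (Fin.toℕ-injective
        (≡.trans (≡.sym (ℕ.m<n⇒m%n≡m (Fin.toℕ<n t))) (≡.trans (≡.sym e) (≡.sym toℕ-t₀))))))) (zeroʳ _)

  Kloost-suc : ∀ r d → Kloost (suc r) d ≈ ΣVec R n r (λ x → Φ d (+ prodℕ r x) * ψ (sumℕ r x))
  Kloost-suc r d = begin
    Kloost (suc r) d
      ≈⟨ ΣVec-unfold R r summand-ext ⟩
    ΣFin R n (λ y → ΣVec R n r (λ x → summand (y ∷ x)))
      ≈⟨ Σ-cong (ΣFin-isSummation R n) (λ y → Σ-cong (ΣVec-isSummation R n r) (λ x → split y x)) ⟩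
    ΣFin R n (λ y → ΣVec R n r (λ x → φ x y * ψ (sumℕ r x)))
      ≈⟨ ΣFin-swap R n (ΣVec-isSummation R n r) (λ y x → φ x y * ψ (sumℕ r x)) ⟩
    ΣVec R n r (λ x → ΣFin R n (λ y → φ x y * ψ (sumℕ r x)))
      ≈⟨ Σ-cong (ΣVec-isSummation R n r) (λ x → Σ-*ʳ (ΣFin-isSummation R n) (ψ (sumℕ r x)) (φ x)) ⟩
    ΣVec R n r (λ x → Φ d (+ prodℕ r x) * ψ (sumℕ r x)) ∎
    where
    summand : (Fin (suc r) → Fin n) → Carrier
    summand x = when R (prodℕ (suc r) x ℕ.% n ℕ.≟ d ℕ.% n) (ψ (sumℕ (suc r) x))
    summand-ext : Extensional R summand
    summand-ext {x} {y} x≗y =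
      when-cong R (prodℕ (suc r) x ℕ.% n ℕ.≟ d ℕ.% n) (prodℕ (suc r) y ℕ.% n ℕ.≟ d ℕ.% n)
        (≡.trans (≡.cong (ℕ._% n) (≡.sym (prodℕ-cong (suc r) x≗y))))
        (≡.trans (≡.cong (ℕ._% n) (prodℕ-cong (suc r) x≗y)))
        (reflexive (≡.cong ψ (sumℕ-cong (suc r) x≗y)))
    φ : (Fin r → Fin n) → Fin n → Carrier
    φ x y = when R (+ toℕ y ℤ.* + prodℕ r x ≟ₙ d) (ψ (toℕ y))
    split : ∀ y x → summand (y ∷ x) ≈ φ x y * ψ (sumℕ r x)
    split y x = trans (when-≟ₙ-cong {+ (toℕ y ℕ.* prodℕ r x)} d (≡⇒≡-mod (ℤ.pos-* (toℕ y) (prodℕ r x)))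
                                     (ψ-+ (toℕ y) (sumℕ r x)))
                      (when-*ʳ R (+ toℕ y ℤ.* + prodℕ r x ≟ₙ d) (ψ (toℕ y)) (ψ (sumℕ r x)))

  Ψ-cofactors-degenerate : ∀ d {r} (B : Fin r → Fin r → Fin n) v → Degenerate (cofactors B v) →
                           Ψ d r (cofactors B v) ≈ fromℕ R (n ℕ.^ r) * Φ d (detℤ r ⟦ B ⟧)
  Ψ-cofactors-degenerate d {r} B v degenerate =
    trans (Ψ-degenerate d r (cofactors B v) (λ j → %ℕ≡⇒≡-mod (degenerate j)))
          (*-congˡ (Φ-cong d (≡⇒≡-mod (cofactors-zero B v))))

  Ψ-cofactors-nondegenerate : ∀ d {r} (B : Fin r → Fin r → Fin n) v → ¬ Degenerate (cofactors B v) →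
                              Ψ d r (cofactors B v) ≈ 0#
  Ψ-cofactors-nondegenerate d {r} B v ¬degenerate
    with Fin.¬∀⟶∃¬ r _ (λ j → cofactors B v (suc j) %ℕ n ℕ.≟ 0) ¬degenerate
  ... | j , cⱼ≢0 = Ψ-vanishes d r (cofactors B v) j cⱼ≢0

  ΣΨ-cofactors : ∀ d r (B : Fin r → Fin r → Fin n) →
                 ΣVec R n r (λ v → Ψ d r (cofactors B v)) ≈ fromℕ R (n ℕ.^ r) * Φ d (detℤ r ⟦ B ⟧)
  ΣΨ-cofactors d r B with gcd (detℤ r ⟦ B ⟧ %ℕ n) n ℕ.≟ 1
  ... | yes coprime =
    trans (ΣVec-δ R r ext (λ _ → zero) (λ v v≉0 → Ψ-cofactors-nondegenerate d B v (v≉0 ∘ cramer B coprime v)))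
          (Ψ-cofactors-degenerate d B (λ _ → zero) (cofactors-origin B))
    where
    ext : Extensional R (λ v → Ψ d r (cofactors B v))
    ext {v} {v′} v≗v′ = Ψ-cong d r (cofactor-cong {B = ⟦ zipWith _∷_ v B ⟧} {⟦ zipWith _∷_ v′ B ⟧}
      (λ i → λ { zero → ≡.cong (+_ ∘ toℕ) (v≗v′ i) ; (suc k) → ≡.refl }))
  ... | no ¬coprime =
    trans (Σ-≈0 (ΣVec-isSummation R n r) term≈0) (sym (trans (*-congˡ Φ≈0) (zeroʳ _)))
    where
    Φ≈0 : Φ d (detℤ r ⟦ B ⟧) ≈ 0#
    Φ≈0 = Φ-vanishes d (detℤ r ⟦ B ⟧) ¬coprime
    term≈0 : ∀ v → Ψ d r (cofactors B v) ≈ 0#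
    term≈0 v with Fin.all? (λ j → cofactors B v (suc j) %ℕ n ℕ.≟ 0)
    ... | yes degenerate = trans (Ψ-cofactors-degenerate d B v degenerate) (trans (*-congˡ Φ≈0) (zeroʳ _))
    ... | no ¬degenerate = Ψ-cofactors-nondegenerate d B v ¬degenerate

  lowerRowsTerm : ℕ → ∀ r → (Fin r → Fin (suc r) → Fin n) → Carrier
  lowerRowsTerm d r Bᵣ = Ψ d r (cofactor ⟦ Bᵣ ⟧) * ψ (trℕ r (λ i j → Bᵣ i (suc j)))

  Gauss-expand : ∀ r d → Gauss (suc r) d ≈ ΣMat R n r (suc r) (lowerRowsTerm d r)
  Gauss-expand r d = begin
    Gauss (suc r) d
      ≈⟨ ΣMat-unfold R r (suc r) summand-ext ⟩
    ΣVec R n (suc r) (λ x → ΣMat R n r (suc r) (λ Bᵣ → summand (x ∷ Bᵣ)))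
      ≈⟨ ΣVec-swap R n (suc r) (ΣMat-isSummation R n r (suc r)) (λ x Bᵣ → summand (x ∷ Bᵣ)) ⟩
    ΣMat R n r (suc r) (λ Bᵣ → ΣVec R n (suc r) (λ x → summand (x ∷ Bᵣ)))
      ≈⟨ Σ-cong (ΣMat-isSummation R n r (suc r)) first-row ⟩
    ΣMat R n r (suc r) (lowerRowsTerm d r) ∎
    where
    summand : Mat (suc r) n → Carrier
    summand X = when R (detℤ (suc r) ⟦ X ⟧ ≟ₙ d) (ψ (trℕ (suc r) X))
    summand-ext : Extensional₂ R summand
    summand-ext {X} {Y} X≗Y =
      when-≟ₙ-cong d (≡⇒≡-mod (detℤ-cong (suc r) (λ i j → ≡.cong (+_ ∘ toℕ) (X≗Y i j))))
                     (reflexive (≡.cong ψ (trℕ-cong (suc r) X≗Y)))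
    first-row : ∀ Bᵣ → ΣVec R n (suc r) (λ x → summand (x ∷ Bᵣ)) ≈ lowerRowsTerm d r Bᵣ
    first-row Bᵣ = trans
      (Σ-cong (ΣVec-isSummation R n (suc r)) (λ x →
        trans (when-≟ₙ-cong d (≡⇒≡-mod (detℤ-expand r (⟦ x ∷ Bᵣ ⟧ zero) ⟦ Bᵣ ⟧))
                              (ψ-+ (toℕ (x zero)) (trℕ r (λ i j → Bᵣ i (suc j)))))
              (when-*ʳ R (x · cofactor ⟦ Bᵣ ⟧ ≟ₙ d) _ _)))
      (Σ-*ʳ (ΣVec-isSummation R n (suc r)) _ (Ψ-term d (cofactor ⟦ Bᵣ ⟧)))

  Gauss-suc : ∀ r d →
              Gauss (suc r) d ≈ fromℕ R (n ℕ.^ r) * ΣMat R n r r (λ B → Φ d (detℤ r ⟦ B ⟧) * ψ (trℕ r B))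
  Gauss-suc r d = begin
    Gauss (suc r) d
      ≈⟨ Gauss-expand r d ⟩
    ΣMat R n r (suc r) (lowerRowsTerm d r)
      ≈⟨ ΣMat-columns R r r term-ext ⟩
    ΣVec R n r (λ v → ΣMat R n r r (λ B → Ψ d r (cofactors B v) * ψ (trℕ r B)))
      ≈⟨ ΣVec-swap R n r (ΣMat-isSummation R n r r) (λ v B → Ψ d r (cofactors B v) * ψ (trℕ r B)) ⟩
    ΣMat R n r r (λ B → ΣVec R n r (λ v → Ψ d r (cofactors B v) * ψ (trℕ r B)))
      ≈⟨ Σ-cong (ΣMat-isSummation R n r r) (λ B →
           trans (Σ-*ʳ (ΣVec-isSummation R n r) (ψ (trℕ r B)) (λ v → Ψ d r (cofactors B v)))
                 (*-congʳ (ΣΨ-cofactors d r B))) ⟩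
    ΣMat R n r r (λ B → N * Φ d (detℤ r ⟦ B ⟧) * ψ (trℕ r B))
      ≈⟨ Σ-cong (ΣMat-isSummation R n r r) (λ B → *-assoc _ _ _) ⟩
    ΣMat R n r r (λ B → N * (Φ d (detℤ r ⟦ B ⟧) * ψ (trℕ r B)))
      ≈⟨ Σ-*ˡ (ΣMat-isSummation R n r r) N (λ B → Φ d (detℤ r ⟦ B ⟧) * ψ (trℕ r B)) ⟩
    N * ΣMat R n r r (λ B → Φ d (detℤ r ⟦ B ⟧) * ψ (trℕ r B)) ∎
    where
    N = fromℕ R (n ℕ.^ r)
    term-ext : Extensional₂ R (lowerRowsTerm d r)
    term-ext {B} {B′} B≗B′ =
      *-cong (Ψ-cong d r (cofactor-cong {B = ⟦ B ⟧} {⟦ B′ ⟧} (λ i j → ≡.cong (+_ ∘ toℕ) (B≗B′ i j))))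
             (reflexive (≡.cong ψ (trℕ-cong r (λ i j → B≗B′ i (suc j)))))

  Gauss≈Kloost : ∀ r d → Gauss r d ≈ fromℕ R (n ℕ.^ (r C 2)) * Kloost r d
  Gauss≈Kloost zero d = sym (trans (*-congʳ (fromℕ-1 R)) (*-identityˡ _))
  Gauss≈Kloost (suc r) d = begin
    Gauss (suc r) d
      ≈⟨ Gauss-suc r d ⟩
    N * ΣMat R n r r (λ B → Φ d (detℤ r ⟦ B ⟧) * ψ (trℕ r B))
      ≈⟨ *-congˡ (Σ-by-residue (ΣMat-isSummation R n r r) (Φ d) (Φ-cong d)
                               (λ B → detℤ r ⟦ B ⟧) (ψ ∘ trℕ r)) ⟩
    N * ΣFin R n (λ t → Φ d (+ toℕ t) * Gauss r (toℕ t))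
      ≈⟨ *-congˡ (Σ-cong (ΣFin-isSummation R n) (λ t →
           trans (*-congˡ (Gauss≈Kloost r (toℕ t))) (x∙yz≈y∙xz (Φ d (+ toℕ t)) M (Kloost r (toℕ t))))) ⟩
    N * ΣFin R n (λ t → M * (Φ d (+ toℕ t) * Kloost r (toℕ t)))
      ≈⟨ *-congˡ (Σ-*ˡ (ΣFin-isSummation R n) M (λ t → Φ d (+ toℕ t) * Kloost r (toℕ t))) ⟩
    N * (M * ΣFin R n (λ t → Φ d (+ toℕ t) * Kloost r (toℕ t)))
      ≈⟨ *-assoc _ _ _ ⟨
    N * M * ΣFin R n (λ t → Φ d (+ toℕ t) * Kloost r (toℕ t))
      ≈⟨ *-cong (sym N*M≈)
                (Σ-by-residue (ΣVec-isSummation R n r) (Φ d) (Φ-cong d) (λ x → + prodℕ r x) (ψ ∘ sumℕ r)) ⟨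
    fromℕ R (n ℕ.^ (suc r C 2)) * ΣVec R n r (λ x → Φ d (+ prodℕ r x) * ψ (sumℕ r x))
      ≈⟨ *-congˡ (Kloost-suc r d) ⟨
    fromℕ R (n ℕ.^ (suc r C 2)) * Kloost (suc r) d ∎
    where
    open import Algebra.Properties.CommutativeSemigroup *-commutativeSemigroup using (x∙yz≈y∙xz)
    N = fromℕ R (n ℕ.^ r)
    M = fromℕ R (n ℕ.^ (r C 2))
    N*M≈ : N * M ≈ fromℕ R (n ℕ.^ (suc r C 2))
    N*M≈ = begin
      N * M                              ≈⟨ fromℕ-* R (n ℕ.^ r) (n ℕ.^ (r C 2)) ⟨
      fromℕ R (n ℕ.^ r ℕ.* n ℕ.^ (r C 2)) ≡⟨ ≡.cong (fromℕ R) (ℕ.^-distribˡ-+-* n r (r C 2)) ⟨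
      fromℕ R (n ℕ.^ (r ℕ.+ r C 2))      ≡⟨ ≡.cong (λ e → fromℕ R (n ℕ.^ e)) (n+nC2≡[1+n]C2 r) ⟩
      fromℕ R (n ℕ.^ (suc r C 2))        ∎

open import Data.Nat using (NonZero; _≤_; _^_; _*_; _∸_)
open import Data.Nat.DivMod using (_/_)
open import Data.Nat.Combinatorics using (_C_)
open import Data.Integer using (ℤ; +_; 1ℤ)
open import Data.Integer.DivMod using (_%ℕ_)
open import Data.Integer.GCD using (gcd)
open import Relation.Binary.PropositionalEquality using (_≡_; cong)
open Congruence using (coprime-%ℕ)
open NatLemmas using (nC2≡n[n∸1]/2)
open GaussKloosterman using (Gauss≈Kloost)

theorem4 : ∀ {c ℓ} (R : CommutativeRing c ℓ) → IsIntegralDomain R → CharZero R →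
    (n r : ℕ) .{{_ : NonZero n}} → 1 ≤ n → 1 ≤ r →
    (a : ℤ) → gcd a (+ n) ≡ 1ℤ →
    (ζ : CommutativeRing.Carrier R) → IsPrimitiveRoot R n ζ →
    CommutativeRing._≈_ R (GaussSL R n ζ a r)
      (CommutativeRing._*_ R (fromℕ R (n ^ ((r * (r ∸ 1)) / 2))) (Kloosterman R n ζ a r))
theorem4 R domain _ (suc m) r _ _ a gcd≡1 ζ ζ-primitive = begin
  GaussSL R (suc m) ζ a r
    ≈⟨ Gauss≈Kloost R domain m ζ ζ-primitive (a %ℕ suc m) (coprime-%ℕ a gcd≡1) r 1 ⟩
  fromℕ R (suc m ^ (r C 2)) *ᴿ Kloosterman R (suc m) ζ a r
    ≡⟨ cong (λ e → fromℕ R (suc m ^ e) *ᴿ Kloosterman R (suc m) ζ a r) (nC2≡n[n∸1]/2 r) ⟩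
  fromℕ R (suc m ^ ((r * (r ∸ 1)) / 2)) *ᴿ Kloosterman R (suc m) ζ a r ∎
  where
  open CommutativeRing R using (setoid) renaming (_*_ to _*ᴿ_)
  open import Relation.Binary.Reasoning.Setoid setoid
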